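{- For every $\mathsf{xFrege}$ proof of length $l$ and size $n$ there exists an $\mathsf{xSKSg}$ proof of the same formula whose length and size are respectively $O(l)$ and $O(n^2)$.
   Context: CoS: formulae built from units $\mathsf f,\mathsf t$, atoms $a,\bar a,\dots$, formula variables $A,\bar A,\dots$ by $[\alpha\vee\beta]$ and $(\alpha\wedge\beta)$; $\bar\cdot$ involution on atoms and on variables with $\bar a\ne a$, $\bar A\ne A$; the De Morgan dual $\bar\alpha$ exchanges $\vee/\wedge$, $\mathsf t/\mathsf f$ and negates atoms and variables. Equality $=$ is the smallest context-closed equivalence containing commutativity and associativity of $\vee,\wedge$, $[\alpha\vee\mathsf f]=\alpha$, $(\alpha\wedge\mathsf t)=\alpha$, $[\mathsf t\vee\mathsf t]=\mathsf t$, $(\mathsf f\wedge\mathsf f)=\mathsf f$. A rule $\alpha/\beta$ has instances $\alpha\rho\sigma/\beta\rho\sigma$ (renaming $\rho$ of atoms, substitution $\sigma$ of formulae for variables, $\bar A\mapsto$ dual) and generates steps $\xi\{\gamma\}/\xi\{\delta\}$ for any context (formula with one hole) $\xi$. A derivation in $\mathcal S$ from premiss $\alpha_0$ to conclusion $\alpha_k$ is a chain alternating $=$-steps and steps generated by rules of $\mathcal S$; length = number of steps; size = number of occurrences of units, atoms, variables. $\mathsf{SKSg}$ has the rules $\mathsf t/[A\vee\bar A]$, $(A\wedge\bar A)/\mathsf f$, $\mathsf f/A$, $A/\mathsf t$, $[A\vee A]/A$, $A/(A\wedge A)$, $(A\wedge[B\vee C])/[(A\wedge B)\vee C]$. $\mathsf{xSKSg}$: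 an extended $\mathsf{SKSg}$ proof of $\alpha$ is an $\mathsf{SKSg}$ derivation with conclusion $\alpha$ and premiss $([\bar A_1\vee\beta_1]\wedge[\bar\beta_1\vee A_1]\wedge\dots\wedge[\bar A_h\vee\beta_h]\wedge[\bar\beta_h\vee A_h])$, where $A_1,\bar A_1,\dots,A_h,\bar A_h$ are mutually distinct variables and, for each $i$, neither $A_i$ nor $\bar A_i$ occurs in $\beta_1,\dots,\beta_i,\alpha$. $\mathsf{Frege}$: formulae over $\mathsf t,\mathsf f$, non-negated variables, $\vee,\wedge,\to,\neg$; axiom schemes $F_1: A\to(B\to(A\wedge B))$; $F_2:(A\wedge B)\to A$; $F_3:(A\wedge B)\to B$; $F_4:A\to(A\vee B)$; $F_5:B\to(A\vee B)$; $F_6:\neg\neg A\to A$; $F_7:A\to\neg\neg A$; $F_8:A\to(B\to A)$; $F_9:\neg A\to(A\to B)$; $F_{10}:(A\to(B\to C))\to((A\to B)\to(A\to C))$; $F_{11}:(A\to C)\to((B\to C)\to((A\vee B)\to C))$; $F_{12}:(A\to(B\to C))\to(B\to(A\to C))$; $F_{13}:(A\to B)\to(\neg B\to\neg A)$; $F_{14}:\mathsf f\to(A\wedge\neg A)$; $F_{15}:(A\wedge\neg A)\to\mathsf f$; $F_{16}:\mathsf t\to(A\vee\neg A)$; $F_{17}:(A\vee\neg A)\to\mathsf t$ (instances by substituting formulae), and modus ponens. $\mathsf{xFrege}$: a proof is a sequence $\alpha_1,\dots,\alpha_k$ (conclusion $\alpha_k$) in which each formula is an axiom instance, follows by modus ponens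 from earlier formulae, or is an extension instance $A\leftrightarrow\beta$ (shorthand for $((A\to\beta)\wedge(\beta\to A))$) with the variable $A$ not occurring in any earlier formula, in $\beta$, or in $\alpha_k$; length = number of formulae; size = number of occurrences of units and variables. Translation: atoms/variables ↔ Frege variables, negated atoms/variables ↔ $\neg$ of variables, $\neg\alpha$ ↔ dual, $\alpha\to\beta$ ↔ $[\bar\alpha\vee\beta]$. -}

module Defs where

open import Data.Nat using (ℕ; zero; suc; _+_; _*_; _≤_)
open import Data.Bool using (Bool; true; false; not)
open import Data.Fin using (Fin; toℕ)
open import Data.Fin.Patterns using (0F)
open import Data.List using (List; []; _∷_; length)
open import Data.List.Membership.Propositional using (_∈_)
open import Data.Product using (Σ; _×_; _,_; proj₁; proj₂)
open import Data.Unit using (⊤; tt)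
open import Relation.Binary.PropositionalEquality using (_≡_)
open import Relation.Nullary using (¬_)
open import Function.Definitions using (Injective)

-- An atom (resp. formula variable) is a name n : ℕ together with a
-- polarity p : Bool.  The involution ̄· flips the polarity, so that
-- ā ≠ a and Ā ≠ A always hold.
Sym : Set
Sym = Bool × ℕ

bar : Sym → Sym
bar (p , n) = (not p , n)

data Fm : Set where
  𝕗 𝕥  : Fm
  atom : Sym → Fm
  var  : Sym → Fm
  [_∨_] : Fm → Fm → Fm
  ⟨_∧_⟩ : Fm → Fm → Fm

dual : Fm → Fm
dual 𝕗 = 𝕥
dual 𝕥 = 𝕗
dual (atom a) = atom (bar a)
dual (var A) = var (bar A)
dual [ α ∨ β ] = ⟨ dual α ∧ dual β ⟩
dual ⟨ α ∧ β ⟩ = [ dual α ∨ dual β ]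

size : Fm → ℕ
size 𝕗 = 1
size 𝕥 = 1
size (atom _) = 1
size (var _) = 1
size [ α ∨ β ] = size α + size β
size ⟨ α ∧ β ⟩ = size α + size β

data VarOcc (n : ℕ) : Fm → Set where
  here  : ∀ p → VarOcc n (var (p , n))
  ∨ˡ : ∀ {α β} → VarOcc n α → VarOcc n [ α ∨ β ]
  ∨ʳ : ∀ {α β} → VarOcc n β → VarOcc n [ α ∨ β ]
  ∧ˡ : ∀ {α β} → VarOcc n α → VarOcc n ⟨ α ∧ β ⟩
  ∧ʳ : ∀ {α β} → VarOcc n β → VarOcc n ⟨ α ∧ β ⟩

data Ctx : Set where
  □    : Ctx
  _∨◂_ : Ctx → Fm → Ctx
  _▸∨_ : Fm → Ctx → Ctx
  _∧◂_ : Ctx → Fm → Ctx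
  _▸∧_ : Fm → Ctx → Ctx

plug : Ctx → Fm → Fm
plug □ γ = γ
plug (ξ ∨◂ β) γ = [ plug ξ γ ∨ β ]
plug (α ▸∨ ξ) γ = [ α ∨ plug ξ γ ]
plug (ξ ∧◂ β) γ = ⟨ plug ξ γ ∧ β ⟩
plug (α ▸∧ ξ) γ = ⟨ α ∧ plug ξ γ ⟩

infix 4 _≃_
data _≃_ : Fm → Fm → Set where
  ≃-refl  : ∀ {α} → α ≃ α
  ≃-sym   : ∀ {α β} → α ≃ β → β ≃ α
  ≃-trans : ∀ {α β γ} → α ≃ β → β ≃ γ → α ≃ γ
  ≃-ctx   : ∀ ξ {α β} → α ≃ β → plug ξ α ≃ plug ξ β
  ∨-comm  : ∀ α β → [ α ∨ β ] ≃ [ β ∨ α ]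
  ∧-comm  : ∀ α β → ⟨ α ∧ β ⟩ ≃ ⟨ β ∧ α ⟩
  ∨-assoc : ∀ α β γ → [ [ α ∨ β ] ∨ γ ] ≃ [ α ∨ [ β ∨ γ ] ]
  ∧-assoc : ∀ α β γ → ⟨ ⟨ α ∧ β ⟩ ∧ γ ⟩ ≃ ⟨ α ∧ ⟨ β ∧ γ ⟩ ⟩
  ∨-unit  : ∀ α → [ α ∨ 𝕗 ] ≃ α
  ∧-unit  : ∀ α → ⟨ α ∧ 𝕥 ⟩ ≃ α
  𝕥∨𝕥     : [ 𝕥 ∨ 𝕥 ] ≃ 𝕥
  𝕗∧𝕗     : ⟨ 𝕗 ∧ 𝕗 ⟩ ≃ 𝕗

-- Instances of the rules of SKSg.  The rules contain no atoms, so
-- renamings ρ act trivially; a substitution σ sends A,B,C to arbitrary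
-- formulae and Ā to the dual of σ(A).
data SKSgInst : Fm → Fm → Set where
  ai↓ : ∀ A → SKSgInst 𝕥 [ A ∨ dual A ]
  ai↑ : ∀ A → SKSgInst ⟨ A ∧ dual A ⟩ 𝕗
  aw↓ : ∀ A → SKSgInst 𝕗 A
  aw↑ : ∀ A → SKSgInst A 𝕥
  ac↓ : ∀ A → SKSgInst [ A ∨ A ] A
  ac↑ : ∀ A → SKSgInst A ⟨ A ∧ A ⟩
  s   : ∀ A B C → SKSgInst ⟨ A ∧ [ B ∨ C ] ⟩ [ ⟨ A ∧ B ⟩ ∨ C ]

data SKSgStep : Fm → Fm → Set where
  step : ∀ ξ {γ δ} → SKSgInst γ δ → SKSgStep (plug ξ γ) (plug ξ δ)

-- Derivations: chains alternating =-steps and rule steps.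
mutual
  data DerE : Fm → Fm → Set where
    nilE : ∀ α → DerE α α
    eqE  : ∀ {α β γ} → α ≃ β → DerR β γ → DerE α γ

  data DerR : Fm → Fm → Set where
    nilR  : ∀ α → DerR α α
    ruleR : ∀ {α β γ} → SKSgStep α β → DerE β γ → DerR α γ

data Derivation (α β : Fm) : Set where
  startE : DerE α β → Derivation α β
  startR : DerR α β → Derivation α β

mutual
  lenE : ∀ {α β} → DerE α β → ℕ
  lenE (nilE _) = 0
  lenE (eqE _ d) = suc (lenR d)

  lenR : ∀ {α β} → DerR α β → ℕ
  lenR (nilR _) = 0
  lenR (ruleR _ d) = suc (lenE d)

mutual
  sizeE⁺ : ∀ {α β} → DerE α β → ℕ
  sizeE⁺ (nilE _) = 0
  sizeE⁺ (eqE {β = β} _ d) = size β + sizeR⁺ d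

  sizeR⁺ : ∀ {α β} → DerR α β → ℕ
  sizeR⁺ (nilR _) = 0
  sizeR⁺ (ruleR {β = β} _ d) = size β + sizeE⁺ d

derLength : ∀ {α β} → Derivation α β → ℕ
derLength (startE d) = lenE d
derLength (startR d) = lenR d

derSize : ∀ {α β} → Derivation α β → ℕ
derSize {α} (startE d) = size α + sizeE⁺ d
derSize {α} (startR d) = size α + sizeR⁺ d

conj : List Fm → Fm
conj [] = 𝕥
conj (γ ∷ []) = γ
conj (γ ∷ γs@(_ ∷ _)) = ⟨ γ ∧ conj γs ⟩

extClauses : ∀ {h} → (Fin h → Sym) → (Fin h → Fm) → List Fm
extClauses {zero} A β = []
extClauses {suc h} A β =
  [ var (bar (A 0F)) ∨ β 0F ] ∷ [ dual (β 0F) ∨ var (A 0F) ] ∷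
  extClauses (λ i → A (Data.Fin.suc i)) (λ i → β (Data.Fin.suc i))

extPremiss : ∀ {h} → (Fin h → Sym) → (Fin h → Fm) → Fm
extPremiss A β = conj (extClauses A β)

record XSKSgProof (α : Fm) : Set where
  field
    h     : ℕ
    A     : Fin h → Sym
    β     : Fin h → Fm
    -- A₁, Ā₁, …, A_h, Ā_h mutually distinct
    distinct : Injective _≡_ _≡_ (λ i → proj₂ (A i))
    freshβ : ∀ (i j : Fin h) → toℕ j ≤ toℕ i → ¬ VarOcc (proj₂ (A i)) (β j)
    freshα : ∀ (i : Fin h) → ¬ VarOcc (proj₂ (A i)) α
    deriv : Derivation (extPremiss A β) α

xLength : ∀ {α} → XSKSgProof α → ℕ
xLength π = derLength (XSKSgProof.deriv π)

xSize : ∀ {α} → XSKSgProof α → ℕ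
xSize π = derSize (XSKSgProof.deriv π)

-- Frege variables correspond to CoS atoms and CoS variables (non-negated)
data FVar : Set where
  fatom : ℕ → FVar
  fvar  : ℕ → FVar

infixr 5 _⇒_
data FFm : Set where
  ⊤ᶠ ⊥ᶠ : FFm
  v    : FVar → FFm
  _∨ᶠ_ : FFm → FFm → FFm
  _∧ᶠ_ : FFm → FFm → FFm
  _⇒_  : FFm → FFm → FFm
  ¬ᶠ_  : FFm → FFm

_⇔_ : FFm → FFm → FFm
A ⇔ B = (A ⇒ B) ∧ᶠ (B ⇒ A)

fsize : FFm → ℕ
fsize ⊤ᶠ = 1
fsize ⊥ᶠ = 1
fsize (v _) = 1
fsize (α ∨ᶠ β) = fsize α + fsize β
fsize (α ∧ᶠ β) = fsize α + fsize β
fsize (α ⇒ β) = fsize α + fsize β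
fsize (¬ᶠ α) = fsize α

data FOcc (x : FVar) : FFm → Set where
  here : FOcc x (v x)
  ∨ˡ : ∀ {α β} → FOcc x α → FOcc x (α ∨ᶠ β)
  ∨ʳ : ∀ {α β} → FOcc x β → FOcc x (α ∨ᶠ β)
  ∧ˡ : ∀ {α β} → FOcc x α → FOcc x (α ∧ᶠ β)
  ∧ʳ : ∀ {α β} → FOcc x β → FOcc x (α ∧ᶠ β)
  ⇒ˡ : ∀ {α β} → FOcc x α → FOcc x (α ⇒ β)
  ⇒ʳ : ∀ {α β} → FOcc x β → FOcc x (α ⇒ β)
  ¬o : ∀ {α} → FOcc x α → FOcc x (¬ᶠ α)

data Axiom : FFm → Set where
  F1  : ∀ A B → Axiom (A ⇒ (B ⇒ (A ∧ᶠ B)))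
  F2  : ∀ A B → Axiom ((A ∧ᶠ B) ⇒ A)
  F3  : ∀ A B → Axiom ((A ∧ᶠ B) ⇒ B)
  F4  : ∀ A B → Axiom (A ⇒ (A ∨ᶠ B))
  F5  : ∀ A B → Axiom (B ⇒ (A ∨ᶠ B))
  F6  : ∀ A → Axiom ((¬ᶠ (¬ᶠ A)) ⇒ A)
  F7  : ∀ A → Axiom (A ⇒ (¬ᶠ (¬ᶠ A)))
  F8  : ∀ A B → Axiom (A ⇒ (B ⇒ A))
  F9  : ∀ A B → Axiom ((¬ᶠ A) ⇒ (A ⇒ B))
  F10 : ∀ A B C → Axiom ((A ⇒ (B ⇒ C)) ⇒ ((A ⇒ B) ⇒ (A ⇒ C)))
  F11 : ∀ A B C → Axiom ((A ⇒ C) ⇒ ((B ⇒ C) ⇒ ((A ∨ᶠ B) ⇒ C)))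
  F12 : ∀ A B C → Axiom ((A ⇒ (B ⇒ C)) ⇒ (B ⇒ (A ⇒ C)))
  F13 : ∀ A B → Axiom ((A ⇒ B) ⇒ ((¬ᶠ B) ⇒ (¬ᶠ A)))
  F14 : ∀ A → Axiom (⊥ᶠ ⇒ (A ∧ᶠ (¬ᶠ A)))
  F15 : ∀ A → Axiom ((A ∧ᶠ (¬ᶠ A)) ⇒ ⊥ᶠ)
  F16 : ∀ A → Axiom (⊤ᶠ ⇒ (A ∨ᶠ (¬ᶠ A)))
  F17 : ∀ A → Axiom ((A ∨ᶠ (¬ᶠ A)) ⇒ ⊤ᶠ)

data Justified (earlier : List FFm) (concl : FFm) : FFm → Set where
  axiom : ∀ {φ} → Axiom φ → Justified earlier concl φ
  mp    : ∀ {φ ψ} → (φ ⇒ ψ) ∈ earlier → φ ∈ earlier → Justified earlier concl ψ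
  ext   : ∀ (A : FVar) (β : FFm) →
          (∀ γ → γ ∈ earlier → ¬ FOcc A γ) →
          ¬ FOcc A β → ¬ FOcc A concl →
          Justified earlier concl (v A ⇔ β)

-- A list of lines, given in REVERSE order (most recent first), each
-- justified by the lines before it.
data ValidRev (concl : FFm) : List FFm → Set where
  []  : ValidRev concl []
  _∷_ : ∀ {φ earlier} → Justified earlier concl φ → ValidRev concl earlier →
        ValidRev concl (φ ∷ earlier)

record XFregeProof (α : FFm) : Set where
  field
    earlierRev : List FFm             -- α_{k-1}, …, α₁
    valid      : ValidRev α (α ∷ earlierRev)

sumSizes : List FFm → ℕ
sumSizes [] = 0
sumSizes (φ ∷ φs) = fsize φ + sumSizes φs

fLength : ∀ {α} → XFregeProof α → ℕ
fLength {α} π = length (α ∷ XFregeProof.earlierRev π)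

fSize : ∀ {α} → XFregeProof α → ℕ
fSize {α} π = sumSizes (α ∷ XFregeProof.earlierRev π)

trVar : FVar → Fm
trVar (fatom n) = atom (true , n)
trVar (fvar n)  = var (true , n)

tr : FFm → Fm
tr ⊤ᶠ = 𝕥
tr ⊥ᶠ = 𝕗
tr (v x) = trVar x
tr (α ∨ᶠ β) = [ tr α ∨ tr β ]
tr (α ∧ᶠ β) = ⟨ tr α ∧ tr β ⟩
tr (α ⇒ β) = [ dual (tr α) ∨ tr β ]
tr (¬ᶠ α) = dual (tr α)

module Submission where

-- An xFrege proof α₁ … α_k of ω is simulated line by line inside a single
-- "memory" formula ⟨ tr α_j ∧ … ∧ tr α₁ ∧ C₁ ∧ … ∧ C_{2h} ∧ 𝕥 ⟩, starting
-- from the extension clauses C of the xSKSg premiss.  Each line is pushed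
-- onto the memory in at most 12 steps: an axiom instance is derived from
-- the unit 𝕥 by a fixed schematic derivation (one per scheme F1–F17); modus
-- ponens copies φ and φ → ψ out of the memory by contraction and weakening
-- and cuts them by a switch; an extension line A ↔ β is copied out of its
-- two premiss clauses the same way.  Finally everything but tr ω is
-- weakened away.  All formulae then have size O(n) and there are O(l)
-- steps, so the derivation has length O(l) and size O(l·n) ⊆ O(n²).
--
-- Derivations are built as free sequences of =-steps
-- and rule steps and only converted once into the alternating format, which
-- at most doubles their length.  And Frege atoms serving as extension
-- variables must become CoS variables, so the translation renames atoms not
-- occurring in the conclusion to fresh variables; the conclusion keeps its
-- translation tr ω since extension variables never occur in it.

open import Defs
open import Data.Bool using (Bool; true; false; T) renaming (_∧_ to _∧ᵇ_)
open import Data.Bool.Properties using (T-∧)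
open import Data.Empty using (⊥-elim)
open import Data.Fin using (Fin; toℕ) renaming (zero to fzero; suc to fsuc)
open import Data.Fin.Patterns using (0F; 1F; 2F)
open import Data.Fin.Properties using (toℕ-injective)
open import Data.List using (List; []; _∷_; _++_; _∷ʳ_; map; lookup; length)
open import Data.List.Properties using (map-++)
open import Data.List.Membership.Propositional using (_∈_)
open import Data.List.Membership.Propositional.Properties using (∈-lookup; ∈-++⁺ˡ; ∈-++⁺ʳ; ∈-map⁺)
open import Data.List.Relation.Unary.Any using (here; there)
open import Data.List.Relation.Unary.All as All using (All; []; _∷_)
open import Data.List.Relation.Unary.All.Properties using (∷ʳ⁺)
open import Data.Nat using (ℕ; suc; _+_; _*_; _≤_; _<_; _≤ᵇ_; z≤n; s≤s; _⊔_)
open import Data.Nat.Properties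
open import Algebra.Properties.CommutativeSemigroup +-commutativeSemigroup using (x∙yz≈y∙xz)
open import Data.Nat.Tactic.RingSolver using (solve-∀)
open import Data.Product using (Σ; _×_; _,_; proj₁; proj₂)
open import Data.Sum using (inj₁; inj₂; [_,_]′)
open import Data.Unit using (⊤; tt)
open import Function using (_∘_)
open import Function.Bundles using (Equivalence)
open import Relation.Binary using (tri<; tri≈; tri>)
open import Relation.Binary.Definitions using (DecidableEquality)
open import Relation.Binary.PropositionalEquality
open import Relation.Nullary using (¬_; Dec; yes; no)
import Relation.Nullary.Decidable as Dec
open import Relation.Nullary.Decidable using (_⊎-dec_)

variable
  α β γ δ : Fm
  M : ℕ

bar-involutive : ∀ x → bar (bar x) ≡ x
bar-involutive (true , n) = refl
bar-involutive (false , n) = refl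

dual-involutive : ∀ α → dual (dual α) ≡ α
dual-involutive 𝕗 = refl
dual-involutive 𝕥 = refl
dual-involutive (atom a) = cong atom (bar-involutive a)
dual-involutive (var a) = cong var (bar-involutive a)
dual-involutive [ α ∨ β ] = cong₂ [_∨_] (dual-involutive α) (dual-involutive β)
dual-involutive ⟨ α ∧ β ⟩ = cong₂ ⟨_∧_⟩ (dual-involutive α) (dual-involutive β)

size-dual : ∀ α → size (dual α) ≡ size α
size-dual 𝕗 = refl
size-dual 𝕥 = refl
size-dual (atom a) = refl
size-dual (var a) = refl
size-dual [ α ∨ β ] = cong₂ _+_ (size-dual α) (size-dual β)
size-dual ⟨ α ∧ β ⟩ = cong₂ _+_ (size-dual α) (size-dual β)

size-pos : ∀ α → 1 ≤ size α
size-pos 𝕗 = s≤s z≤n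
size-pos 𝕥 = s≤s z≤n
size-pos (atom a) = s≤s z≤n
size-pos (var a) = s≤s z≤n
size-pos [ α ∨ β ] = ≤-trans (size-pos α) (m≤m+n _ _)
size-pos ⟨ α ∧ β ⟩ = ≤-trans (size-pos α) (m≤m+n _ _)

infixr 6 _∘ᶜ_
_∘ᶜ_ : Ctx → Ctx → Ctx
□ ∘ᶜ ζ = ζ
(ξ ∨◂ β) ∘ᶜ ζ = (ξ ∘ᶜ ζ) ∨◂ β
(α ▸∨ ξ) ∘ᶜ ζ = α ▸∨ (ξ ∘ᶜ ζ)
(ξ ∧◂ β) ∘ᶜ ζ = (ξ ∘ᶜ ζ) ∧◂ β
(α ▸∧ ξ) ∘ᶜ ζ = α ▸∧ (ξ ∘ᶜ ζ)

plug-∘ᶜ : ∀ ξ ζ γ → plug (ξ ∘ᶜ ζ) γ ≡ plug ξ (plug ζ γ)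
plug-∘ᶜ □ ζ γ = refl
plug-∘ᶜ (ξ ∨◂ β) ζ γ = cong [_∨ β ] (plug-∘ᶜ ξ ζ γ)
plug-∘ᶜ (α ▸∨ ξ) ζ γ = cong [ α ∨_] (plug-∘ᶜ ξ ζ γ)
plug-∘ᶜ (ξ ∧◂ β) ζ γ = cong ⟨_∧ β ⟩ (plug-∘ᶜ ξ ζ γ)
plug-∘ᶜ (α ▸∧ ξ) ζ γ = cong ⟨ α ∧_⟩ (plug-∘ᶜ ξ ζ γ)

step-in : ∀ ξ → SKSgStep α β → SKSgStep (plug ξ α) (plug ξ β)
step-in ξ (step ζ {γ} {δ} r) =
  subst₂ SKSgStep (plug-∘ᶜ ξ ζ γ) (plug-∘ᶜ ξ ζ δ) (step (ξ ∘ᶜ ζ) r)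

ctxSize : Ctx → ℕ
ctxSize □ = 0
ctxSize (ξ ∨◂ β) = ctxSize ξ + size β
ctxSize (α ▸∨ ξ) = size α + ctxSize ξ
ctxSize (ξ ∧◂ β) = ctxSize ξ + size β
ctxSize (α ▸∧ ξ) = size α + ctxSize ξ

size-plug : ∀ ξ γ → size (plug ξ γ) ≡ size γ + ctxSize ξ
size-plug □ γ = sym (+-identityʳ _)
size-plug (ξ ∨◂ β) γ = trans (cong (_+ size β) (size-plug ξ γ)) (+-assoc (size γ) _ _)
size-plug (α ▸∨ ξ) γ = trans (cong (size α +_) (size-plug ξ γ)) (x∙yz≈y∙xz (size α) (size γ) _)
size-plug (ξ ∧◂ β) γ = trans (cong (_+ size β) (size-plug ξ γ)) (+-assoc (size γ) _ _)
size-plug (α ▸∧ ξ) γ = trans (cong (size α +_) (size-plug ξ γ)) (x∙yz≈y∙xz (size α) (size γ) _)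

-- All
-- simulation steps are built in this format; a free derivation is turned
-- into a proper alternating derivation only once, at the very end.

data FreeDer : Fm → Fm → Set where
  done   : FreeDer α α
  byEq   : α ≃ β → FreeDer β γ → FreeDer α γ
  byRule : SKSgStep α β → FreeDer β γ → FreeDer α γ

steps : FreeDer α β → ℕ
steps done = 0
steps (byEq _ d) = suc (steps d)
steps (byRule _ d) = suc (steps d)

Bounded : ℕ → FreeDer α β → Set
Bounded M done = ⊤
Bounded M (byEq {β = β} _ d) = size β ≤ M × Bounded M d
Bounded M (byRule {β = β} _ d) = size β ≤ M × Bounded M d

infixr 5 _++ᶠ_
_++ᶠ_ : FreeDer α β → FreeDer β γ → FreeDer α γ
done ++ᶠ e = e
byEq x d ++ᶠ e = byEq x (d ++ᶠ e)
byRule x d ++ᶠ e = byRule x (d ++ᶠ e)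

steps-++ : (d : FreeDer α β) (e : FreeDer β γ) → steps (d ++ᶠ e) ≡ steps d + steps e
steps-++ done e = refl
steps-++ (byEq x d) e = cong suc (steps-++ d e)
steps-++ (byRule x d) e = cong suc (steps-++ d e)

bounded-++ : (d : FreeDer α β) (e : FreeDer β γ) → Bounded M d → Bounded M e → Bounded M (d ++ᶠ e)
bounded-++ done e _ be = be
bounded-++ (byEq x d) e (p , bd) be = p , bounded-++ d e bd be
bounded-++ (byRule x d) e (p , bd) be = p , bounded-++ d e bd be

bounded-mono : ∀ {M M′} (d : FreeDer α β) → M ≤ M′ → Bounded M d → Bounded M′ d
bounded-mono done le b = tt
bounded-mono (byEq x d) le (p , b) = ≤-trans p le , bounded-mono d le b
bounded-mono (byRule x d) le (p , b) = ≤-trans p le , bounded-mono d le b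

inside : ∀ ξ → FreeDer α β → FreeDer (plug ξ α) (plug ξ β)
inside ξ done = done
inside ξ (byEq e d) = byEq (≃-ctx ξ e) (inside ξ d)
inside ξ (byRule r d) = byRule (step-in ξ r) (inside ξ d)

steps-inside : ∀ ξ (d : FreeDer α β) → steps (inside ξ d) ≡ steps d
steps-inside ξ done = refl
steps-inside ξ (byEq e d) = cong suc (steps-inside ξ d)
steps-inside ξ (byRule r d) = cong suc (steps-inside ξ d)

bounded-inside : ∀ ξ (d : FreeDer α β) → Bounded M d → Bounded (M + ctxSize ξ) (inside ξ d)
bounded-inside ξ done b = tt
bounded-inside ξ (byEq {β = β} e d) (p , b) =
  ≤-trans (≤-reflexive (size-plug ξ β)) (+-monoˡ-≤ _ p) , bounded-inside ξ d b
bounded-inside ξ (byRule {β = β} r d) (p , b) =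
  ≤-trans (≤-reflexive (size-plug ξ β)) (+-monoˡ-≤ _ p) , bounded-inside ξ d b

-- Alternation: consecutive =-steps merge by transitivity, and a trivial
-- =-step is inserted between consecutive rule steps.  This at most doubles
-- the length and introduces no new formula sizes.

mutual
  afterEq : α ≃ β → FreeDer β γ → DerE α γ
  afterEq e done = eqE e (nilR _)
  afterEq e (byEq e′ d) = afterEq (≃-trans e e′) d
  afterEq e (byRule r d) = eqE e (afterRule r d)

  afterRule : SKSgStep α β → FreeDer β γ → DerR α γ
  afterRule r done = ruleR r (nilE _)
  afterRule r (byEq e d) = ruleR r (afterEq e d)
  afterRule r (byRule r′ d) = ruleR r (eqE ≃-refl (afterRule r′ d))

alternate : FreeDer α β → Derivation α β
alternate done = startE (nilE _)
alternate (byEq e d) = startE (afterEq e d)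
alternate (byRule r d) = startR (afterRule r d)

double-suc : ∀ n → suc (suc (n + n)) ≡ suc n + suc n
double-suc n = cong suc (sym (+-suc n n))

suc-double≤ : ∀ n → suc (n + n) ≤ suc n + suc n
suc-double≤ n = ≤-trans (n≤1+n _) (≤-reflexive (double-suc n))

mutual
  afterEq-length : (e : α ≃ β) (d : FreeDer β γ) → lenE (afterEq e d) ≤ suc (steps d + steps d)
  afterEq-length e done = ≤-refl
  afterEq-length e (byEq e′ d) = ≤-trans (afterEq-length (≃-trans e e′) d) (≤-trans (suc-double≤ (steps d)) (n≤1+n _))
  afterEq-length e (byRule r d) = s≤s (≤-trans (afterRule-length r d) (suc-double≤ (steps d)))

  afterRule-length : (r : SKSgStep α β) (d : FreeDer β γ) → lenR (afterRule r d) ≤ suc (steps d + steps d)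
  afterRule-length r done = ≤-refl
  afterRule-length r (byEq e d) = s≤s (≤-trans (afterEq-length e d) (suc-double≤ (steps d)))
  afterRule-length r (byRule r′ d) = s≤s (≤-trans (s≤s (afterRule-length r′ d)) (≤-reflexive (double-suc (steps d))))

alternate-length : (d : FreeDer α β) → derLength (alternate d) ≤ steps d + steps d
alternate-length done = z≤n
alternate-length (byEq e d) = ≤-trans (afterEq-length e d) (suc-double≤ (steps d))
alternate-length (byRule r d) = ≤-trans (afterRule-length r d) (suc-double≤ (steps d))

mutual
  BoundedE : ℕ → DerE α β → Set
  BoundedE M (nilE _) = ⊤
  BoundedE M (eqE {β = β} _ d) = size β ≤ M × BoundedR M d

  BoundedR : ℕ → DerR α β → Set
  BoundedR M (nilR _) = ⊤
  BoundedR M (ruleR {β = β} _ d) = size β ≤ M × BoundedE M d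

mutual
  sizeE⁺-bound : (d : DerE α β) → BoundedE M d → sizeE⁺ d ≤ lenE d * M
  sizeE⁺-bound (nilE _) _ = z≤n
  sizeE⁺-bound (eqE _ d) (p , b) = +-mono-≤ p (sizeR⁺-bound d b)

  sizeR⁺-bound : (d : DerR α β) → BoundedR M d → sizeR⁺ d ≤ lenR d * M
  sizeR⁺-bound (nilR _) _ = z≤n
  sizeR⁺-bound (ruleR _ d) (p , b) = +-mono-≤ p (sizeE⁺-bound d b)

mutual
  afterEq-bounded : (e : α ≃ β) (d : FreeDer β γ) → size β ≤ M → Bounded M d → BoundedE M (afterEq e d)
  afterEq-bounded e done p _ = p , tt
  afterEq-bounded e (byEq e′ d) _ (p , b) = afterEq-bounded (≃-trans e e′) d p b
  afterEq-bounded e (byRule r d) p (p′ , b) = p , afterRule-bounded r d p′ b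

  afterRule-bounded : (r : SKSgStep α β) (d : FreeDer β γ) → size β ≤ M → Bounded M d → BoundedR M (afterRule r d)
  afterRule-bounded r done p _ = p , tt
  afterRule-bounded r (byEq e d) p (p′ , b) = p , afterEq-bounded e d p′ b
  afterRule-bounded r (byRule r′ d) p (p′ , b) = p , p , afterRule-bounded r′ d p′ b

BoundedDer : ℕ → Derivation α β → Set
BoundedDer {α} M (startE d) = size α ≤ M × BoundedE M d
BoundedDer {α} M (startR d) = size α ≤ M × BoundedR M d

derSize-bound : (D : Derivation α β) → BoundedDer M D → derSize D ≤ suc (derLength D) * M
derSize-bound (startE d) (p , b) = +-mono-≤ p (sizeE⁺-bound d b)
derSize-bound (startR d) (p , b) = +-mono-≤ p (sizeR⁺-bound d b)

alternate-bounded : (d : FreeDer α β) → size α ≤ M → Bounded M d → BoundedDer M (alternate d)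
alternate-bounded done p _ = p , tt
alternate-bounded (byEq e d) p (p′ , b) = p , afterEq-bounded e d p′ b
alternate-bounded (byRule r d) p (p′ , b) = p , afterRule-bounded r d p′ b

alternate-size : (d : FreeDer α β) → size α ≤ M → Bounded M d →
                 derSize (alternate d) ≤ suc (steps d + steps d) * M
alternate-size {M = M} d p b =
  ≤-trans (derSize-bound (alternate d) (alternate-bounded d p b)) (*-monoˡ-≤ M (s≤s (alternate-length d)))

-- A derivation written once
-- with schemes yields a derivation of every instance; this is how the
-- seventeen Frege axiom schemes are handled uniformly.

infixr 7 _∧ˢ_
infixr 6 _∨ˢ_
data Scheme : Set where
  𝕥ˢ 𝕗ˢ : Scheme
  pos neg : Fin 3 → Scheme
  _∨ˢ_ _∧ˢ_ : Scheme → Scheme → Scheme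

variable
  t u w : Scheme

Env : Set
Env = Fin 3 → Fm

⟦_⟧ : Scheme → Env → Fm
⟦ 𝕥ˢ ⟧ ρ = 𝕥
⟦ 𝕗ˢ ⟧ ρ = 𝕗
⟦ pos i ⟧ ρ = ρ i
⟦ neg i ⟧ ρ = dual (ρ i)
⟦ t ∨ˢ u ⟧ ρ = [ ⟦ t ⟧ ρ ∨ ⟦ u ⟧ ρ ]
⟦ t ∧ˢ u ⟧ ρ = ⟨ ⟦ t ⟧ ρ ∧ ⟦ u ⟧ ρ ⟩

dualˢ : Scheme → Scheme
dualˢ 𝕥ˢ = 𝕗ˢ
dualˢ 𝕗ˢ = 𝕥ˢ
dualˢ (pos i) = neg i
dualˢ (neg i) = pos i
dualˢ (t ∨ˢ u) = dualˢ t ∧ˢ dualˢ u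
dualˢ (t ∧ˢ u) = dualˢ t ∨ˢ dualˢ u

⟦dualˢ⟧ : ∀ t ρ → ⟦ dualˢ t ⟧ ρ ≡ dual (⟦ t ⟧ ρ)
⟦dualˢ⟧ 𝕥ˢ ρ = refl
⟦dualˢ⟧ 𝕗ˢ ρ = refl
⟦dualˢ⟧ (pos i) ρ = refl
⟦dualˢ⟧ (neg i) ρ = sym (dual-involutive (ρ i))
⟦dualˢ⟧ (t ∨ˢ u) ρ = cong₂ ⟨_∧_⟩ (⟦dualˢ⟧ t ρ) (⟦dualˢ⟧ u ρ)
⟦dualˢ⟧ (t ∧ˢ u) ρ = cong₂ [_∨_] (⟦dualˢ⟧ t ρ) (⟦dualˢ⟧ u ρ)

data SchemeCtx : Set where
  □ˢ : SchemeCtx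
  _∨◂ˢ_ : SchemeCtx → Scheme → SchemeCtx
  _▸∨ˢ_ : Scheme → SchemeCtx → SchemeCtx
  _∧◂ˢ_ : SchemeCtx → Scheme → SchemeCtx
  _▸∧ˢ_ : Scheme → SchemeCtx → SchemeCtx

plugˢ : SchemeCtx → Scheme → Scheme
plugˢ □ˢ t = t
plugˢ (ξ ∨◂ˢ b) t = plugˢ ξ t ∨ˢ b
plugˢ (a ▸∨ˢ ξ) t = a ∨ˢ plugˢ ξ t
plugˢ (ξ ∧◂ˢ b) t = plugˢ ξ t ∧ˢ b
plugˢ (a ▸∧ˢ ξ) t = a ∧ˢ plugˢ ξ t

⟦_⟧ᶜ : SchemeCtx → Env → Ctx
⟦ □ˢ ⟧ᶜ ρ = □
⟦ ξ ∨◂ˢ b ⟧ᶜ ρ = ⟦ ξ ⟧ᶜ ρ ∨◂ ⟦ b ⟧ ρ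
⟦ a ▸∨ˢ ξ ⟧ᶜ ρ = ⟦ a ⟧ ρ ▸∨ ⟦ ξ ⟧ᶜ ρ
⟦ ξ ∧◂ˢ b ⟧ᶜ ρ = ⟦ ξ ⟧ᶜ ρ ∧◂ ⟦ b ⟧ ρ
⟦ a ▸∧ˢ ξ ⟧ᶜ ρ = ⟦ a ⟧ ρ ▸∧ ⟦ ξ ⟧ᶜ ρ

⟦plugˢ⟧ : ∀ ξ t ρ → ⟦ plugˢ ξ t ⟧ ρ ≡ plug (⟦ ξ ⟧ᶜ ρ) (⟦ t ⟧ ρ)
⟦plugˢ⟧ □ˢ t ρ = refl
⟦plugˢ⟧ (ξ ∨◂ˢ b) t ρ = cong [_∨ ⟦ b ⟧ ρ ] (⟦plugˢ⟧ ξ t ρ)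
⟦plugˢ⟧ (a ▸∨ˢ ξ) t ρ = cong [ ⟦ a ⟧ ρ ∨_] (⟦plugˢ⟧ ξ t ρ)
⟦plugˢ⟧ (ξ ∧◂ˢ b) t ρ = cong ⟨_∧ ⟦ b ⟧ ρ ⟩ (⟦plugˢ⟧ ξ t ρ)
⟦plugˢ⟧ (a ▸∧ˢ ξ) t ρ = cong ⟨ ⟦ a ⟧ ρ ∧_⟩ (⟦plugˢ⟧ ξ t ρ)

data SchemeInst : Scheme → Scheme → Set where
  ai↓ˢ : ∀ X → SchemeInst 𝕥ˢ (X ∨ˢ dualˢ X)
  aw↓ˢ : ∀ X → SchemeInst 𝕗ˢ X
  ac↓ˢ : ∀ X → SchemeInst (X ∨ˢ X) X
  ac↑ˢ : ∀ X → SchemeInst X (X ∧ˢ X)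
  sˢ   : ∀ X Y Z → SchemeInst (X ∧ˢ (Y ∨ˢ Z)) ((X ∧ˢ Y) ∨ˢ Z)

⟦_⟧ⁱ : SchemeInst t u → ∀ ρ → SKSgInst (⟦ t ⟧ ρ) (⟦ u ⟧ ρ)
⟦ ai↓ˢ X ⟧ⁱ ρ = subst (λ z → SKSgInst 𝕥 [ ⟦ X ⟧ ρ ∨ z ]) (sym (⟦dualˢ⟧ X ρ)) (ai↓ _)
⟦ aw↓ˢ X ⟧ⁱ ρ = aw↓ _
⟦ ac↓ˢ X ⟧ⁱ ρ = ac↓ _
⟦ ac↑ˢ X ⟧ⁱ ρ = ac↑ _
⟦ sˢ X Y Z ⟧ⁱ ρ = s _ _ _

data SchemeDer : Scheme → Scheme → Set where
  doneˢ : SchemeDer t t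
  byEqˢ : ∀ u → (∀ ρ → ⟦ t ⟧ ρ ≃ ⟦ u ⟧ ρ) → SchemeDer u w → SchemeDer t w
  byRuleˢ : ∀ ξ → SchemeInst t u → SchemeDer (plugˢ ξ u) w → SchemeDer (plugˢ ξ t) w

stepsˢ : SchemeDer t w → ℕ
stepsˢ doneˢ = 0
stepsˢ (byEqˢ u e d) = suc (stepsˢ d)
stepsˢ (byRuleˢ ξ r d) = suc (stepsˢ d)

instantiate : SchemeDer t w → ∀ ρ → FreeDer (⟦ t ⟧ ρ) (⟦ w ⟧ ρ)
instantiate doneˢ ρ = done
instantiate (byEqˢ u e d) ρ = byEq (e ρ) (instantiate d ρ)
instantiate (byRuleˢ {t} {u} ξ r d) ρ =
  byRule (subst₂ SKSgStep (sym (⟦plugˢ⟧ ξ t ρ)) (sym (⟦plugˢ⟧ ξ u ρ)) (step (⟦ ξ ⟧ᶜ ρ) (⟦ r ⟧ⁱ ρ)))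
         (instantiate d ρ)

steps-instantiate : (d : SchemeDer t w) → ∀ ρ → steps (instantiate d ρ) ≡ stepsˢ d
steps-instantiate doneˢ ρ = refl
steps-instantiate (byEqˢ u e d) ρ = cong suc (steps-instantiate d ρ)
steps-instantiate (byRuleˢ ξ r d) ρ = cong suc (steps-instantiate d ρ)

-- The size of ⟦ t ⟧ ρ is a linear form in the
-- sizes of ρ X₀, ρ X₁, ρ X₂ whose coefficients (the numbers of occurrences)
-- and constant term (the number of units) can be read off t.

same : Fin 3 → Fin 3 → ℕ
same 0F 0F = 1
same 1F 1F = 1
same 2F 2F = 1
same _ _ = 0

occurrences : Fin 3 → Scheme → ℕ
occurrences i 𝕥ˢ = 0
occurrences i 𝕗ˢ = 0
occurrences i (pos j) = same i j
occurrences i (neg j) = same i j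
occurrences i (t ∨ˢ u) = occurrences i t + occurrences i u
occurrences i (t ∧ˢ u) = occurrences i t + occurrences i u

units : Scheme → ℕ
units 𝕥ˢ = 1
units 𝕗ˢ = 1
units (pos _) = 0
units (neg _) = 0
units (t ∨ˢ u) = units t + units u
units (t ∧ˢ u) = units t + units u

weight : Scheme → Env → ℕ
weight t ρ = units t + (occurrences 0F t * size (ρ 0F) + (occurrences 1F t * size (ρ 1F) + occurrences 2F t * size (ρ 2F)))

size-metavariable : ∀ j ρ → size (ρ j) ≡ weight (pos j) ρ
size-metavariable 0F ρ = coefficients (size (ρ 0F)) (size (ρ 1F)) (size (ρ 2F))
  where coefficients : ∀ a b c → a ≡ 0 + (1 * a + (0 * b + 0 * c))
        coefficients = solve-∀
size-metavariable 1F ρ = coefficients (size (ρ 0F)) (size (ρ 1F)) (size (ρ 2F))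
  where coefficients : ∀ a b c → b ≡ 0 + (0 * a + (1 * b + 0 * c))
        coefficients = solve-∀
size-metavariable 2F ρ = coefficients (size (ρ 0F)) (size (ρ 1F)) (size (ρ 2F))
  where coefficients : ∀ a b c → c ≡ 0 + (0 * a + (0 * b + 1 * c))
        coefficients = solve-∀

add-forms : ∀ u₁ u₂ x₁ x₂ y₁ y₂ z₁ z₂ a b c →
  (u₁ + (x₁ * a + (y₁ * b + z₁ * c))) + (u₂ + (x₂ * a + (y₂ * b + z₂ * c)))
  ≡ (u₁ + u₂) + ((x₁ + x₂) * a + ((y₁ + y₂) * b + (z₁ + z₂) * c))
add-forms = solve-∀

-- (the weights of t ∨ˢ u and t ∧ˢ u coincide)
weight-sum : ∀ t u ρ → weight t ρ + weight u ρ ≡ weight (t ∨ˢ u) ρ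
weight-sum t u ρ =
  add-forms (units t) (units u) (occurrences 0F t) (occurrences 0F u) (occurrences 1F t) (occurrences 1F u)
            (occurrences 2F t) (occurrences 2F u) (size (ρ 0F)) (size (ρ 1F)) (size (ρ 2F))

size-weight : ∀ t ρ → size (⟦ t ⟧ ρ) ≡ weight t ρ
size-weight 𝕥ˢ ρ = refl
size-weight 𝕗ˢ ρ = refl
size-weight (pos j) ρ = size-metavariable j ρ
size-weight (neg j) ρ = trans (size-dual (ρ j)) (size-metavariable j ρ)
size-weight (t ∨ˢ u) ρ = trans (cong₂ _+_ (size-weight t ρ) (size-weight u ρ)) (weight-sum t u ρ)
size-weight (t ∧ˢ u) ρ = trans (cong₂ _+_ (size-weight t ρ) (size-weight u ρ)) (weight-sum t u ρ)

-- This is a decidable check on closed schemes and guarantees that every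
-- instance of t is at most 4 times as large as the same instance of g.

dominatedᵇ : Scheme → Scheme → Bool
dominatedᵇ t g =
  (occurrences 0F t ≤ᵇ 2 * occurrences 0F g) ∧ᵇ ((occurrences 1F t ≤ᵇ 2 * occurrences 1F g) ∧ᵇ
  ((occurrences 2F t ≤ᵇ 2 * occurrences 2F g) ∧ᵇ
   (units t ≤ᵇ 2 * (units g + (occurrences 0F g + (occurrences 1F g + occurrences 2F g))))))

-- the arithmetic core: with all values of size ≥ 1, the unit excess is paid by the leaves
dominated-form : ∀ u c₀ c₁ c₂ u′ c₀′ c₁′ c₂′ s₀ s₁ s₂ → 1 ≤ s₀ → 1 ≤ s₁ → 1 ≤ s₂ →
  c₀ ≤ 2 * c₀′ → c₁ ≤ 2 * c₁′ → c₂ ≤ 2 * c₂′ → u ≤ 2 * (u′ + (c₀′ + (c₁′ + c₂′))) →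
  u + (c₀ * s₀ + (c₁ * s₁ + c₂ * s₂)) ≤ 4 * (u′ + (c₀′ * s₀ + (c₁′ * s₁ + c₂′ * s₂)))
dominated-form u c₀ c₁ c₂ u′ c₀′ c₁′ c₂′ s₀ s₁ s₂ p₀ p₁ p₂ h₀ h₁ h₂ hᵤ =
  ≤-trans (+-mono-≤ units-bound (≤-trans leaves-bound (*-monoʳ-≤ 2 (m≤n+m Y u′))))
          (≤-reflexive (twice-twice (u′ + Y)))
  where
  Y : ℕ
  Y = c₀′ * s₀ + (c₁′ * s₁ + c₂′ * s₂)
  ≤-scaled : ∀ c {k} → 1 ≤ k → c ≤ c * k
  ≤-scaled c h = ≤-trans (≤-reflexive (sym (*-identityʳ c))) (*-monoʳ-≤ c h)
  leaves≤Y : c₀′ + (c₁′ + c₂′) ≤ Y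
  leaves≤Y = +-mono-≤ (≤-scaled c₀′ p₀) (+-mono-≤ (≤-scaled c₁′ p₁) (≤-scaled c₂′ p₂))
  units-bound : u ≤ 2 * (u′ + Y)
  units-bound = ≤-trans hᵤ (*-monoʳ-≤ 2 (+-monoʳ-≤ u′ leaves≤Y))
  scale : ∀ a b c x y z → (2 * a) * x + ((2 * b) * y + (2 * c) * z) ≡ 2 * (a * x + (b * y + c * z))
  scale = solve-∀
  leaves-bound : c₀ * s₀ + (c₁ * s₁ + c₂ * s₂) ≤ 2 * Y
  leaves-bound = ≤-trans (+-mono-≤ (*-monoˡ-≤ s₀ h₀) (+-mono-≤ (*-monoˡ-≤ s₁ h₁) (*-monoˡ-≤ s₂ h₂)))
                         (≤-reflexive (scale c₀′ c₁′ c₂′ s₀ s₁ s₂))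
  twice-twice : ∀ x → 2 * x + 2 * x ≡ 4 * x
  twice-twice = solve-∀

dominated-size : ∀ t g ρ → T (dominatedᵇ t g) → size (⟦ t ⟧ ρ) ≤ 4 * size (⟦ g ⟧ ρ)
dominated-size t g ρ p
  with q₀ , p₁ ← Equivalence.to T-∧ p
  with q₁ , p₂ ← Equivalence.to T-∧ p₁
  with q₂ , qᵤ ← Equivalence.to T-∧ p₂ =
  begin
    size (⟦ t ⟧ ρ)     ≡⟨ size-weight t ρ ⟩
    weight t ρ         ≤⟨ dominated-form (units t) (occurrences 0F t) (occurrences 1F t) (occurrences 2F t)
                                         (units g) (occurrences 0F g) (occurrences 1F g) (occurrences 2F g)
                                         (size (ρ 0F)) (size (ρ 1F)) (size (ρ 2F))
                                         (size-pos (ρ 0F)) (size-pos (ρ 1F)) (size-pos (ρ 2F))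
                            (≤ᵇ⇒≤ _ _ q₀) (≤ᵇ⇒≤ _ _ q₁) (≤ᵇ⇒≤ _ _ q₂) (≤ᵇ⇒≤ _ _ qᵤ) ⟩
    4 * weight g ρ     ≡⟨ cong (4 *_) (sym (size-weight g ρ)) ⟩
    4 * size (⟦ g ⟧ ρ) ∎
  where open ≤-Reasoning

allDominatedᵇ : SchemeDer t w → Scheme → Bool
allDominatedᵇ doneˢ g = true
allDominatedᵇ (byEqˢ u e d) g = dominatedᵇ u g ∧ᵇ allDominatedᵇ d g
allDominatedᵇ (byRuleˢ {u = u} ξ r d) g = dominatedᵇ (plugˢ ξ u) g ∧ᵇ allDominatedᵇ d g

bounded-instantiate : (d : SchemeDer t w) → ∀ g ρ → T (allDominatedᵇ d g) →
                      Bounded (4 * size (⟦ g ⟧ ρ)) (instantiate d ρ)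
bounded-instantiate doneˢ g ρ p = tt
bounded-instantiate (byEqˢ u e d) g ρ p with q , r ← Equivalence.to T-∧ p =
  dominated-size u g ρ q , bounded-instantiate d g ρ r
bounded-instantiate (byRuleˢ {u = u} ξ r d) g ρ p with q , r′ ← Equivalence.to T-∧ p =
  dominated-size (plugˢ ξ u) g ρ q , bounded-instantiate d g ρ r′

trWith : (FVar → Fm) → FFm → Fm
trWith σ ⊤ᶠ = 𝕥
trWith σ ⊥ᶠ = 𝕗
trWith σ (v x) = σ x
trWith σ (α ∨ᶠ β) = [ trWith σ α ∨ trWith σ β ]
trWith σ (α ∧ᶠ β) = ⟨ trWith σ α ∧ trWith σ β ⟩
trWith σ (α ⇒ β) = [ dual (trWith σ α) ∨ trWith σ β ]
trWith σ (¬ᶠ α) = dual (trWith σ α)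

infixr 5 _⇒ˢ_
data FScheme : Set where
  meta : Fin 3 → FScheme
  ⊤ˢ ⊥ˢ : FScheme
  _∨ᶠˢ_ _∧ᶠˢ_ _⇒ˢ_ : FScheme → FScheme → FScheme
  ¬ˢ_ : FScheme → FScheme

instanceOf : FScheme → (Fin 3 → FFm) → FFm
instanceOf (meta i) as = as i
instanceOf ⊤ˢ as = ⊤ᶠ
instanceOf ⊥ˢ as = ⊥ᶠ
instanceOf (x ∨ᶠˢ y) as = instanceOf x as ∨ᶠ instanceOf y as
instanceOf (x ∧ᶠˢ y) as = instanceOf x as ∧ᶠ instanceOf y as
instanceOf (x ⇒ˢ y) as = instanceOf x as ⇒ instanceOf y as
instanceOf (¬ˢ x) as = ¬ᶠ instanceOf x as

toScheme : FScheme → Scheme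
toScheme (meta i) = pos i
toScheme ⊤ˢ = 𝕥ˢ
toScheme ⊥ˢ = 𝕗ˢ
toScheme (x ∨ᶠˢ y) = toScheme x ∨ˢ toScheme y
toScheme (x ∧ᶠˢ y) = toScheme x ∧ˢ toScheme y
toScheme (x ⇒ˢ y) = dualˢ (toScheme x) ∨ˢ toScheme y
toScheme (¬ˢ x) = dualˢ (toScheme x)

trWith-instance : ∀ σ φ as → trWith σ (instanceOf φ as) ≡ ⟦ toScheme φ ⟧ (λ i → trWith σ (as i))
trWith-instance σ (meta i) as = refl
trWith-instance σ ⊤ˢ as = refl
trWith-instance σ ⊥ˢ as = refl
trWith-instance σ (x ∨ᶠˢ y) as = cong₂ [_∨_] (trWith-instance σ x as) (trWith-instance σ y as)
trWith-instance σ (x ∧ᶠˢ y) as = cong₂ ⟨_∧_⟩ (trWith-instance σ x as) (trWith-instance σ y as)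
trWith-instance σ (x ⇒ˢ y) as =
  cong₂ [_∨_] (trans (cong dual (trWith-instance σ x as)) (sym (⟦dualˢ⟧ (toScheme x) _))) (trWith-instance σ y as)
trWith-instance σ (¬ˢ x) as = trans (cong dual (trWith-instance σ x as)) (sym (⟦dualˢ⟧ (toScheme x) _))

AxiomDer : Fm → Set
AxiomDer γ = Σ (FreeDer 𝕥 γ) λ D → steps D ≤ 11 × Bounded (4 * size γ) D

fromScheme : ∀ σ φ as (d : SchemeDer 𝕥ˢ (toScheme φ)) →
             T (allDominatedᵇ d (toScheme φ)) → T (stepsˢ d ≤ᵇ 11) → AxiomDer (trWith σ (instanceOf φ as))
fromScheme σ φ as d dominated short rewrite trWith-instance σ φ as =
  instantiate d ρ ,
  ≤-trans (≤-reflexive (steps-instantiate d ρ)) (≤ᵇ⇒≤ _ _ short) ,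
  bounded-instantiate d (toScheme φ) ρ dominated
  where
  ρ : Env
  ρ i = trWith σ (as i)

Aˢ Bˢ Cˢ : FScheme
Aˢ = meta 0F
Bˢ = meta 1F
Cˢ = meta 2F

a ā b b̄ c c̄ : Scheme
a = pos 0F
ā = neg 0F
b = pos 1F
b̄ = neg 1F
c = pos 2F
c̄ = neg 2F

infixr 4 _⟫_
_⟫_ : α ≃ β → β ≃ γ → α ≃ γ
_⟫_ = ≃-trans

F1ˢ : FScheme
F1ˢ = (Aˢ ⇒ˢ (Bˢ ⇒ˢ (Aˢ ∧ᶠˢ Bˢ)))

F1-derivation : SchemeDer 𝕥ˢ (toScheme F1ˢ)
F1-derivation = byEqˢ (𝕥ˢ ∧ˢ 𝕥ˢ) (λ ρ → ≃-sym (∧-unit _))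
  (byRuleˢ (□ˢ ∧◂ˢ 𝕥ˢ) (ai↓ˢ a)
  (byRuleˢ ((a ∨ˢ ā) ▸∧ˢ □ˢ) (ai↓ˢ b)
  (byRuleˢ □ˢ (sˢ (a ∨ˢ ā) b b̄)
  (byEqˢ ((b ∧ˢ (a ∨ˢ ā)) ∨ˢ b̄) (λ ρ → ≃-ctx (□ ∨◂ _) (∧-comm _ _))
  (byRuleˢ (□ˢ ∨◂ˢ b̄) (sˢ b a ā)
  (byEqˢ (ā ∨ˢ (b̄ ∨ˢ (a ∧ˢ b)))
    (λ ρ → ∨-assoc _ _ _ ⟫ ∨-comm _ _ ⟫ ∨-assoc _ _ _ ⟫ ≃-ctx (_ ▸∨ (_ ▸∨ □)) (∧-comm _ _))
  doneˢ))))))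

F2ˢ : FScheme
F2ˢ = ((Aˢ ∧ᶠˢ Bˢ) ⇒ˢ Aˢ)

F2-derivation : SchemeDer 𝕥ˢ (toScheme F2ˢ)
F2-derivation = byRuleˢ □ˢ (ai↓ˢ a)
  (byEqˢ (a ∨ˢ (ā ∨ˢ 𝕗ˢ)) (λ ρ → ≃-ctx (_ ▸∨ □) (≃-sym (∨-unit _)))
  (byRuleˢ (a ▸∨ˢ (ā ▸∨ˢ □ˢ)) (aw↓ˢ b̄) (byEqˢ _ (λ ρ → ∨-comm _ _) doneˢ)))

F3ˢ : FScheme
F3ˢ = ((Aˢ ∧ᶠˢ Bˢ) ⇒ˢ Bˢ)

F3-derivation : SchemeDer 𝕥ˢ (toScheme F3ˢ)
F3-derivation = byRuleˢ □ˢ (ai↓ˢ b)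
  (byEqˢ (b ∨ˢ (𝕗ˢ ∨ˢ b̄)) (λ ρ → ≃-ctx (_ ▸∨ □) (≃-sym (∨-unit _) ⟫ ∨-comm _ _))
  (byRuleˢ (b ▸∨ˢ (□ˢ ∨◂ˢ b̄)) (aw↓ˢ ā) (byEqˢ _ (λ ρ → ∨-comm _ _) doneˢ)))

F4ˢ : FScheme
F4ˢ = (Aˢ ⇒ˢ (Aˢ ∨ᶠˢ Bˢ))

F4-derivation : SchemeDer 𝕥ˢ (toScheme F4ˢ)
F4-derivation = byRuleˢ □ˢ (ai↓ˢ a)
  (byEqˢ (ā ∨ˢ (a ∨ˢ 𝕗ˢ)) (λ ρ → ∨-comm _ _ ⟫ ≃-ctx (_ ▸∨ □) (≃-sym (∨-unit _)))
  (byRuleˢ (ā ▸∨ˢ (a ▸∨ˢ □ˢ)) (aw↓ˢ b) doneˢ))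

F5ˢ : FScheme
F5ˢ = (Bˢ ⇒ˢ (Aˢ ∨ᶠˢ Bˢ))

F5-derivation : SchemeDer 𝕥ˢ (toScheme F5ˢ)
F5-derivation = byRuleˢ □ˢ (ai↓ˢ b)
  (byEqˢ (b̄ ∨ˢ (𝕗ˢ ∨ˢ b)) (λ ρ → ∨-comm _ _ ⟫ ≃-ctx (_ ▸∨ □) (≃-sym (∨-unit _) ⟫ ∨-comm _ _))
  (byRuleˢ (b̄ ▸∨ˢ (□ˢ ∨◂ˢ b)) (aw↓ˢ a) doneˢ))

F6ˢ : FScheme
F6ˢ = ((¬ˢ (¬ˢ Aˢ)) ⇒ˢ Aˢ)

F6-derivation : SchemeDer 𝕥ˢ (toScheme F6ˢ)
F6-derivation = byRuleˢ □ˢ (ai↓ˢ a)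
  (byEqˢ (ā ∨ˢ a) (λ ρ → ∨-comm _ _) doneˢ)

F7ˢ : FScheme
F7ˢ = (Aˢ ⇒ˢ (¬ˢ (¬ˢ Aˢ)))

F7-derivation : SchemeDer 𝕥ˢ (toScheme F7ˢ)
F7-derivation = byRuleˢ □ˢ (ai↓ˢ a)
  (byEqˢ (ā ∨ˢ a) (λ ρ → ∨-comm _ _) doneˢ)

F8ˢ : FScheme
F8ˢ = (Aˢ ⇒ˢ (Bˢ ⇒ˢ Aˢ))

F8-derivation : SchemeDer 𝕥ˢ (toScheme F8ˢ)
F8-derivation = byRuleˢ □ˢ (ai↓ˢ a)
  (byEqˢ (ā ∨ˢ (𝕗ˢ ∨ˢ a)) (λ ρ → ∨-comm _ _ ⟫ ≃-ctx (_ ▸∨ □) (≃-sym (∨-unit _) ⟫ ∨-comm _ _))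
  (byRuleˢ (ā ▸∨ˢ (□ˢ ∨◂ˢ a)) (aw↓ˢ b̄) doneˢ))

F9ˢ : FScheme
F9ˢ = ((¬ˢ Aˢ) ⇒ˢ (Aˢ ⇒ˢ Bˢ))

F9-derivation : SchemeDer 𝕥ˢ (toScheme F9ˢ)
F9-derivation = byRuleˢ □ˢ (ai↓ˢ a)
  (byEqˢ (a ∨ˢ (ā ∨ˢ 𝕗ˢ)) (λ ρ → ≃-ctx (_ ▸∨ □) (≃-sym (∨-unit _)))
  (byRuleˢ (a ▸∨ˢ (ā ▸∨ˢ □ˢ)) (aw↓ˢ b) doneˢ))

F10ˢ : FScheme
F10ˢ = ((Aˢ ⇒ˢ (Bˢ ⇒ˢ Cˢ)) ⇒ˢ ((Aˢ ⇒ˢ Bˢ) ⇒ˢ (Aˢ ⇒ˢ Cˢ)))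

F10-derivation : SchemeDer 𝕥ˢ (toScheme F10ˢ)
F10-derivation = byRuleˢ □ˢ (ai↓ˢ a)
  (byRuleˢ (□ˢ ∨◂ˢ ā) (ac↑ˢ a)
  (byEqˢ ((a ∧ˢ (a ∧ˢ 𝕥ˢ)) ∨ˢ ā) (λ ρ → ≃-ctx ((_ ▸∧ □) ∨◂ _) (≃-sym (∧-unit _)))
  (byRuleˢ ((a ▸∧ˢ (a ▸∧ˢ □ˢ)) ∨◂ˢ ā) (ai↓ˢ b)
  (byRuleˢ ((a ▸∧ˢ □ˢ) ∨◂ˢ ā) (sˢ a b b̄)
  (byEqˢ ((a ∧ˢ (b̄ ∨ˢ (a ∧ˢ b))) ∨ˢ ā) (λ ρ → ≃-ctx ((_ ▸∧ □) ∨◂ _) (∨-comm _ _))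
  (byRuleˢ (□ˢ ∨◂ˢ ā) (sˢ a b̄ (a ∧ˢ b))
  (byEqˢ (((a ∧ˢ b̄) ∨ˢ ((a ∧ˢ b) ∧ˢ 𝕥ˢ)) ∨ˢ ā) (λ ρ → ≃-ctx ((_ ▸∨ □) ∨◂ _) (≃-sym (∧-unit _)))
  (byRuleˢ (((a ∧ˢ b̄) ▸∨ˢ ((a ∧ˢ b) ▸∧ˢ □ˢ)) ∨◂ˢ ā) (ai↓ˢ c̄)
  (byRuleˢ (((a ∧ˢ b̄) ▸∨ˢ □ˢ) ∨◂ˢ ā) (sˢ (a ∧ˢ b) c̄ c)
  (byEqˢ ((a ∧ˢ (b ∧ˢ c̄)) ∨ˢ ((a ∧ˢ b̄) ∨ˢ (ā ∨ˢ c)))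
    (λ ρ → ∨-assoc _ _ _ ⟫ ≃-ctx (_ ▸∨ □) (∨-assoc _ _ _) ⟫ ≃-sym (∨-assoc _ _ _)
         ⟫ ≃-ctx (□ ∨◂ _) (∨-comm _ _) ⟫ ∨-assoc _ _ _ ⟫ ≃-ctx (_ ▸∨ (_ ▸∨ □)) (∨-comm _ _)
         ⟫ ≃-ctx (□ ∨◂ _) (∧-assoc _ _ _))
  doneˢ))))))))))

F11ˢ : FScheme
F11ˢ = ((Aˢ ⇒ˢ Cˢ) ⇒ˢ ((Bˢ ⇒ˢ Cˢ) ⇒ˢ ((Aˢ ∨ᶠˢ Bˢ) ⇒ˢ Cˢ)))

F11-derivation : SchemeDer 𝕥ˢ (toScheme F11ˢ)
F11-derivation = byRuleˢ □ˢ (ai↓ˢ (a ∨ˢ b))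
  (byEqˢ (((a ∧ˢ 𝕥ˢ) ∨ˢ (b ∧ˢ 𝕥ˢ)) ∨ˢ (ā ∧ˢ b̄))
    (λ ρ → ≃-ctx (□ ∨◂ _) (≃-ctx (□ ∨◂ _) (≃-sym (∧-unit _)) ⟫ ≃-ctx (_ ▸∨ □) (≃-sym (∧-unit _))))
  (byRuleˢ (((a ▸∧ˢ □ˢ) ∨◂ˢ (b ∧ˢ 𝕥ˢ)) ∨◂ˢ (ā ∧ˢ b̄)) (ai↓ˢ c̄)
  (byRuleˢ (((a ∧ˢ (c̄ ∨ˢ c)) ▸∨ˢ (b ▸∧ˢ □ˢ)) ∨◂ˢ (ā ∧ˢ b̄)) (ai↓ˢ c̄)
  (byRuleˢ ((□ˢ ∨◂ˢ (b ∧ˢ (c̄ ∨ˢ c))) ∨◂ˢ (ā ∧ˢ b̄)) (sˢ a c̄ c)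
  (byRuleˢ ((((a ∧ˢ c̄) ∨ˢ c) ▸∨ˢ □ˢ) ∨◂ˢ (ā ∧ˢ b̄)) (sˢ b c̄ c)
  (byEqˢ ((a ∧ˢ c̄) ∨ˢ ((b ∧ˢ c̄) ∨ˢ ((ā ∧ˢ b̄) ∨ˢ (c ∨ˢ c))))
    (λ ρ → ∨-assoc _ _ _ ⟫ ∨-assoc _ _ _ ⟫ ≃-ctx (_ ▸∨ □) (∨-comm _ _)
         ⟫ ≃-ctx (_ ▸∨ □) (∨-assoc _ _ _) ⟫ ≃-ctx (_ ▸∨ □) (∨-assoc _ _ _)
         ⟫ ≃-ctx (_ ▸∨ (_ ▸∨ □)) (≃-sym (∨-assoc _ _ _))
         ⟫ ≃-ctx (_ ▸∨ (_ ▸∨ (□ ∨◂ _))) (∨-comm _ _)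
         ⟫ ≃-ctx (_ ▸∨ (_ ▸∨ □)) (∨-assoc _ _ _))
  (byRuleˢ ((a ∧ˢ c̄) ▸∨ˢ ((b ∧ˢ c̄) ▸∨ˢ ((ā ∧ˢ b̄) ▸∨ˢ □ˢ))) (ac↓ˢ c) doneˢ)))))))

F12ˢ : FScheme
F12ˢ = ((Aˢ ⇒ˢ (Bˢ ⇒ˢ Cˢ)) ⇒ˢ (Bˢ ⇒ˢ (Aˢ ⇒ˢ Cˢ)))

F12-derivation : SchemeDer 𝕥ˢ (toScheme F12ˢ)
F12-derivation = byRuleˢ □ˢ (ai↓ˢ (a ∧ˢ (b ∧ˢ c̄)))
  (byEqˢ _ (λ ρ → ≃-ctx (_ ▸∨ □) (≃-sym (∨-assoc _ _ _) ⟫ ≃-ctx (□ ∨◂ _) (∨-comm _ _) ⟫ ∨-assoc _ _ _)) doneˢ)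

F13ˢ : FScheme
F13ˢ = ((Aˢ ⇒ˢ Bˢ) ⇒ˢ ((¬ˢ Bˢ) ⇒ˢ (¬ˢ Aˢ)))

F13-derivation : SchemeDer 𝕥ˢ (toScheme F13ˢ)
F13-derivation = byRuleˢ □ˢ (ai↓ˢ (a ∧ˢ b̄)) (byEqˢ _ (λ ρ → ≃-ctx (_ ▸∨ □) (∨-comm _ _)) doneˢ)

F14ˢ : FScheme
F14ˢ = (⊥ˢ ⇒ˢ (Aˢ ∧ᶠˢ (¬ˢ Aˢ)))

F14-derivation : SchemeDer 𝕥ˢ (toScheme F14ˢ)
F14-derivation = byEqˢ (𝕥ˢ ∨ˢ 𝕗ˢ) (λ ρ → ≃-sym (∨-unit _))
  (byRuleˢ (𝕥ˢ ▸∨ˢ □ˢ) (aw↓ˢ (a ∧ˢ ā)) doneˢ)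

F15ˢ : FScheme
F15ˢ = ((Aˢ ∧ᶠˢ (¬ˢ Aˢ)) ⇒ˢ ⊥ˢ)

F15-derivation : SchemeDer 𝕥ˢ (toScheme F15ˢ)
F15-derivation = byRuleˢ □ˢ (ai↓ˢ a)
  (byEqˢ ((ā ∨ˢ a) ∨ˢ 𝕗ˢ) (λ ρ → ∨-comm _ _ ⟫ ≃-sym (∨-unit _)) doneˢ)

F16ˢ : FScheme
F16ˢ = (⊤ˢ ⇒ˢ (Aˢ ∨ᶠˢ (¬ˢ Aˢ)))

F16-derivation : SchemeDer 𝕥ˢ (toScheme F16ˢ)
F16-derivation = byRuleˢ □ˢ (ai↓ˢ a)
  (byEqˢ (𝕗ˢ ∨ˢ (a ∨ˢ ā)) (λ ρ → ≃-sym (∨-unit _) ⟫ ∨-comm _ _) doneˢ)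

F17ˢ : FScheme
F17ˢ = ((Aˢ ∨ᶠˢ (¬ˢ Aˢ)) ⇒ˢ ⊤ˢ)

F17-derivation : SchemeDer 𝕥ˢ (toScheme F17ˢ)
F17-derivation = byEqˢ (𝕗ˢ ∨ˢ 𝕥ˢ) (λ ρ → ≃-sym (∨-unit _) ⟫ ∨-comm _ _)
  (byRuleˢ (□ˢ ∨◂ˢ 𝕥ˢ) (aw↓ˢ (ā ∧ˢ a)) doneˢ)

args : FFm → FFm → FFm → Fin 3 → FFm
args A B C 0F = A
args A B C 1F = B
args A B C 2F = C

-- Each axiom instance has a derivation from 𝕥; the two arguments tt are
-- the domination and length checks, which hold by computation.
axiomDerivation : ∀ σ {φ} → Axiom φ → AxiomDer (trWith σ φ)
axiomDerivation σ (F1 A B) = fromScheme σ F1ˢ (args A B A) F1-derivation tt tt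
axiomDerivation σ (F2 A B) = fromScheme σ F2ˢ (args A B A) F2-derivation tt tt
axiomDerivation σ (F3 A B) = fromScheme σ F3ˢ (args A B A) F3-derivation tt tt
axiomDerivation σ (F4 A B) = fromScheme σ F4ˢ (args A B A) F4-derivation tt tt
axiomDerivation σ (F5 A B) = fromScheme σ F5ˢ (args A B A) F5-derivation tt tt
axiomDerivation σ (F6 A) = fromScheme σ F6ˢ (args A A A) F6-derivation tt tt
axiomDerivation σ (F7 A) = fromScheme σ F7ˢ (args A A A) F7-derivation tt tt
axiomDerivation σ (F8 A B) = fromScheme σ F8ˢ (args A B A) F8-derivation tt tt
axiomDerivation σ (F9 A B) = fromScheme σ F9ˢ (args A B A) F9-derivation tt tt
axiomDerivation σ (F10 A B C) = fromScheme σ F10ˢ (args A B C) F10-derivation tt tt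
axiomDerivation σ (F11 A B C) = fromScheme σ F11ˢ (args A B C) F11-derivation tt tt
axiomDerivation σ (F12 A B C) = fromScheme σ F12ˢ (args A B C) F12-derivation tt tt
axiomDerivation σ (F13 A B) = fromScheme σ F13ˢ (args A B A) F13-derivation tt tt
axiomDerivation σ (F14 A) = fromScheme σ F14ˢ (args A A A) F14-derivation tt tt
axiomDerivation σ (F15 A) = fromScheme σ F15ˢ (args A A A) F15-derivation tt tt
axiomDerivation σ (F16 A) = fromScheme σ F16ˢ (args A A A) F16-derivation tt tt
axiomDerivation σ (F17 A) = fromScheme σ F17ˢ (args A A A) F17-derivation tt tt

stack : List Fm → Fm
stack [] = 𝕥
stack (γ ∷ l) = ⟨ γ ∧ stack l ⟩

sizes : List Fm → ℕ
sizes [] = 0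
sizes (γ ∷ l) = size γ + sizes l

size-stack : ∀ l → size (stack l) ≡ suc (sizes l)
size-stack [] = refl
size-stack (γ ∷ l) = trans (cong (size γ +_) (size-stack l)) (+-suc (size γ) (sizes l))

sizes-++ : ∀ l m → sizes (l ++ m) ≡ sizes l + sizes m
sizes-++ [] m = refl
sizes-++ (γ ∷ l) m = trans (cong (size γ +_) (sizes-++ l m)) (sym (+-assoc (size γ) _ _))

select : ∀ l → γ ∈ l → Σ Fm λ R → (stack l ≃ ⟨ γ ∧ R ⟩) × (size γ + size R ≡ size (stack l))
select (δ ∷ l) (here refl) = stack l , ≃-refl , refl
select {γ} (δ ∷ l) (there p) with R , e , eq ← select l p =
  ⟨ δ ∧ R ⟩ ,
  (≃-ctx (δ ▸∧ □) e ⟫ ≃-sym (∧-assoc _ _ _) ⟫ ≃-ctx (□ ∧◂ R) (∧-comm _ _) ⟫ ∧-assoc _ _ _) ,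
  trans (x∙yz≈y∙xz (size γ) (size δ) (size R)) (cong (size δ +_) eq)

member-size : ∀ l → γ ∈ l → size γ ≤ size (stack l)
member-size l p with R , _ , eq ← select l p = ≤-trans (m≤m+n _ (size R)) (≤-reflexive eq)

three-parts : ∀ {p q r X} → p ≤ X → q ≤ X → r ≤ X → (p + q) + r ≤ 3 * X
three-parts {X = X} hp hq hr = ≤-trans (+-mono-≤ (+-mono-≤ hp hq) hr) (≤-reflexive (thrice X))
  where thrice : ∀ X → (X + X) + X ≡ 3 * X
        thrice = solve-∀

-- Copying two members γ, δ of the memory to the front: duplicate the
-- memory twice by contraction, bring γ and δ to the front of the copies and
-- weaken the rest of the copies away.
copyPair : ∀ l → γ ∈ l → δ ∈ l →
  Σ (FreeDer (stack l) ⟨ ⟨ γ ∧ δ ⟩ ∧ stack l ⟩) λ D → steps D ≤ 6 × Bounded (3 * size (stack l)) D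
copyPair {γ} {δ} l pγ pδ
  with Rγ , eγ , sγ ← select l pγ
  with Rδ , eδ , sδ ← select l pδ =
  D , ≤-refl ,
  +-monoʳ-≤ (size X) (m≤m+n (size X) _) ,
  with-memory ≤-refl ≤-refl ,
  with-memory (≤-reflexive sγ) (≤-reflexive sδ) ,
  with-memory γ𝕥≤X (≤-reflexive sδ) ,
  with-memory γ𝕥≤X δ𝕥≤X ,
  with-memory (≤-trans (m≤m+n (size γ) 1) γ𝕥≤X) (≤-trans (m≤m+n (size δ) 1) δ𝕥≤X) , tt
  where
  X : Fm
  X = stack l
  D : FreeDer X ⟨ ⟨ γ ∧ δ ⟩ ∧ X ⟩
  D = byRule (step □ (ac↑ X))
    (byRule (step (□ ∧◂ X) (ac↑ X))
    (byEq (≃-ctx (□ ∧◂ X) (≃-ctx (□ ∧◂ X) eγ ⟫ ≃-ctx (⟨ γ ∧ Rγ ⟩ ▸∧ □) eδ))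
    (byRule (step (((γ ▸∧ □) ∧◂ ⟨ δ ∧ Rδ ⟩) ∧◂ X) (aw↑ Rγ))
    (byRule (step ((⟨ γ ∧ 𝕥 ⟩ ▸∧ (δ ▸∧ □)) ∧◂ X) (aw↑ Rδ))
    (byEq (≃-ctx (□ ∧◂ X) (≃-ctx (□ ∧◂ _) (∧-unit γ) ⟫ ≃-ctx (γ ▸∧ □) (∧-unit δ)))
    done)))))
  -- after the first step, every formula is ⟨ ⟨ p ∧ q ⟩ ∧ X ⟩ with p, q no larger than X
  with-memory : ∀ {p q} → p ≤ size X → q ≤ size X → (p + q) + size X ≤ 3 * size X
  with-memory hp hq = three-parts hp hq ≤-refl
  γ𝕥≤X : size γ + 1 ≤ size X
  γ𝕥≤X = ≤-trans (+-monoʳ-≤ (size γ) (size-pos Rγ)) (≤-reflexive sγ)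
  δ𝕥≤X : size δ + 1 ≤ size X
  δ𝕥≤X = ≤-trans (+-monoʳ-≤ (size δ) (size-pos Rδ)) (≤-reflexive sδ)

Push : List Fm → Fm → ℕ → Set
Push l γ M = Σ (FreeDer (stack l) ⟨ γ ∧ stack l ⟩) λ D → steps D ≤ 12 × Bounded M D

-- Modus ponens: copy φ and [ φ̄ ∨ ψ ] to the front, then cut φ against φ̄
-- by a switch and an identity-up step.
modusPonens : ∀ l {φ ψ} → [ dual φ ∨ ψ ] ∈ l → φ ∈ l → Push l ψ (3 * size (stack l))
modusPonens l {φ} {ψ} p⇒ pφ with C , steps-C , bounded-C ← copyPair l p⇒ pφ =
  C ++ᶠ cut ,
  ≤-trans (≤-reflexive (steps-++ C cut)) (+-mono-≤ steps-C (m≤m+n 4 2)) ,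
  bounded-++ C cut bounded-C
    ( φ-and-implication
    , ≤-trans (≤-reflexive (cong (_+ size X) (+-assoc (size φ) _ _))) φ-and-implication
    , 𝕗-or-ψ
    , ≤-trans (+-monoˡ-≤ (size X) (n≤1+n _)) 𝕗-or-ψ
    , tt )
  where
  X : Fm
  X = stack l
  cut : FreeDer ⟨ ⟨ [ dual φ ∨ ψ ] ∧ φ ⟩ ∧ X ⟩ ⟨ ψ ∧ X ⟩
  cut = byEq (≃-ctx (□ ∧◂ X) (∧-comm _ _))
      (byRule (step (□ ∧◂ X) (s φ (dual φ) ψ))
      (byRule (step ((□ ∨◂ ψ) ∧◂ X) (ai↑ φ))
      (byEq (≃-ctx (□ ∧◂ X) (∨-comm _ _ ⟫ ∨-unit _))
      done)))
  implication≤X : size (dual φ) + size ψ ≤ size X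
  implication≤X = member-size l p⇒
  φ-and-implication : (size φ + (size (dual φ) + size ψ)) + size X ≤ 3 * size X
  φ-and-implication = three-parts (member-size l pφ) implication≤X ≤-refl
  𝕗-or-ψ : (1 + size ψ) + size X ≤ 3 * size X
  𝕗-or-ψ = three-parts (size-pos X) (≤-trans (m≤n+m _ _) implication≤X) ≤-refl

-- An axiom instance γ is derived from the unit 𝕥 of ⟨ 𝕥 ∧ stack l ⟩.
pushAxiom : ∀ l → AxiomDer γ → Push l γ (4 * size γ + 3 * size (stack l))
pushAxiom {γ} l (D , steps-D , bounded-D) =
  byEq (≃-sym (∧-comm 𝕥 X ⟫ ∧-unit X)) (inside (□ ∧◂ X) D) ,
  s≤s (≤-trans (≤-reflexive (steps-inside (□ ∧◂ X) D)) steps-D) ,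
  +-mono-≤ (≤-trans (size-pos γ) (m≤m+n (size γ) _)) (m≤m+n (size X) _) ,
  bounded-mono (inside (□ ∧◂ X) D) (+-monoʳ-≤ (4 * size γ) (m≤m+n (size X) _)) (bounded-inside (□ ∧◂ X) D bounded-D)
  where
  X : Fm
  X = stack l

push-mono : ∀ {l M M′} → M ≤ M′ → Push l γ M → Push l γ M′
push-mono le (D , steps-D , bounded-D) = D , steps-D , bounded-mono D le bounded-D

then-push : ∀ {l k} → (D : FreeDer α (stack l)) → steps D ≤ 12 * k → Bounded M D → Push l γ M →
            Σ (FreeDer α (stack (γ ∷ l))) λ D′ → steps D′ ≤ 12 * suc k × Bounded M D′
then-push {k = k} D steps-D bounded-D (P , steps-P , bounded-P) =
  D ++ᶠ P ,
  ≤-trans (≤-reflexive (steps-++ D P))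
          (≤-trans (+-mono-≤ steps-D steps-P) (≤-reflexive (trans (+-comm (12 * k) 12) (sym (*-suc 12 k))))) ,
  bounded-++ D P bounded-D bounded-P

Definition : Set
Definition = FVar × FFm

variable
  ω φ : FFm
  L : List FFm
  d : Definition

definingLine : Definition → FFm
definingLine (A , β) = v A ⇔ β

-- The definitions of an xFrege proof, oldest first.
definitions : ValidRev ω L → List Definition
definitions [] = []
definitions (axiom _ ∷ V) = definitions V
definitions (mp _ _ ∷ V) = definitions V
definitions (ext A β _ _ _ ∷ V) = definitions V ∷ʳ (A , β)

WellDefined : FFm → List FFm → Definition → Set
WellDefined ω L (A , β) = (definingLine (A , β) ∈ L) × ¬ FOcc A ω × ¬ FOcc A β

wellDefined-later : WellDefined ω L d → WellDefined ω (φ ∷ L) d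
wellDefined-later (m , fω , fβ) = there m , fω , fβ

definitions-wellDefined : (V : ValidRev ω L) → All (WellDefined ω L) (definitions V)
definitions-wellDefined [] = []
definitions-wellDefined (axiom _ ∷ V) = All.map wellDefined-later (definitions-wellDefined V)
definitions-wellDefined (mp _ _ ∷ V) = All.map wellDefined-later (definitions-wellDefined V)
definitions-wellDefined (ext A β _ fβ fω ∷ V) =
  ∷ʳ⁺ (All.map wellDefined-later (definitions-wellDefined V)) (here refl , fω , fβ)

Stratified : List Definition → Set
Stratified [] = ⊤
Stratified (d ∷ ds) = All (λ d′ → ¬ FOcc (proj₁ d′) (definingLine d)) ds × Stratified ds

stratified-∷ʳ : ∀ ds d → Stratified ds → All (λ d′ → ¬ FOcc (proj₁ d) (definingLine d′)) ds →
                Stratified (ds ∷ʳ d)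
stratified-∷ʳ [] d _ _ = [] , tt
stratified-∷ʳ (d′ ∷ ds) d (fresh , rest) (f ∷ fs) = ∷ʳ⁺ fresh f , stratified-∷ʳ ds d rest fs

-- A new definition's variable occurs in no earlier line, in particular in
-- no earlier defining line.
definitions-stratified : (V : ValidRev ω L) → Stratified (definitions V)
definitions-stratified [] = tt
definitions-stratified (axiom _ ∷ V) = definitions-stratified V
definitions-stratified (mp _ _ ∷ V) = definitions-stratified V
definitions-stratified (ext A β fresh _ _ ∷ V) =
  stratified-∷ʳ (definitions V) (A , β) (definitions-stratified V)
    (All.map (λ (m , _) → fresh _ m) (definitions-wellDefined V))

stratified-lookup : ∀ ds → Stratified ds → (i j : Fin (length ds)) → toℕ i < toℕ j →
                    ¬ FOcc (proj₁ (lookup ds j)) (definingLine (lookup ds i))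
stratified-lookup (d ∷ ds) (fresh , _) fzero (fsuc j) _ = All.lookup fresh (∈-lookup j)
stratified-lookup (d ∷ ds) (_ , rest) (fsuc i) (fsuc j) (s≤s i<j) = stratified-lookup ds rest i j i<j

sumSizes-++ : ∀ l m → sumSizes (l ++ m) ≡ sumSizes l + sumSizes m
sumSizes-++ [] m = refl
sumSizes-++ (φ ∷ l) m = trans (cong (fsize φ +_) (sumSizes-++ l m)) (sym (+-assoc (fsize φ) _ _))

-- The defining lines are among the lines of the proof.
definitions-size : (V : ValidRev ω L) → sumSizes (map definingLine (definitions V)) ≤ sumSizes L
definitions-size [] = z≤n
definitions-size (axiom {φ} _ ∷ V) = ≤-trans (definitions-size V) (m≤n+m _ (fsize φ))
definitions-size (mp {ψ = ψ} _ _ ∷ V) = ≤-trans (definitions-size V) (m≤n+m _ (fsize ψ))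
definitions-size (_∷_ {earlier = earlier} (ext A β _ _ _) V) = begin
  sumSizes (map definingLine (definitions V ∷ʳ (A , β)))
    ≡⟨ cong sumSizes (map-++ definingLine (definitions V) _) ⟩
  sumSizes (map definingLine (definitions V) ++ (v A ⇔ β ∷ []))
    ≡⟨ sumSizes-++ (map definingLine (definitions V)) _ ⟩
  sumSizes (map definingLine (definitions V)) + (fsize (v A ⇔ β) + 0)
    ≡⟨ +-comm (sumSizes (map definingLine (definitions V))) _ ⟩
  (fsize (v A ⇔ β) + 0) + sumSizes (map definingLine (definitions V))
    ≤⟨ +-mono-≤ (≤-reflexive (+-identityʳ _)) (definitions-size V) ⟩
  fsize (v A ⇔ β) + sumSizes earlier ∎
  where open ≤-Reasoning

trWith-agree : ∀ σ φ → (∀ x → FOcc x φ → σ x ≡ trVar x) → trWith σ φ ≡ tr φ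
trWith-agree σ ⊤ᶠ h = refl
trWith-agree σ ⊥ᶠ h = refl
trWith-agree σ (v x) h = h x here
trWith-agree σ (α ∨ᶠ β) h =
  cong₂ [_∨_] (trWith-agree σ α (λ x o → h x (∨ˡ o))) (trWith-agree σ β (λ x o → h x (∨ʳ o)))
trWith-agree σ (α ∧ᶠ β) h =
  cong₂ ⟨_∧_⟩ (trWith-agree σ α (λ x o → h x (∧ˡ o))) (trWith-agree σ β (λ x o → h x (∧ʳ o)))
trWith-agree σ (α ⇒ β) h =
  cong₂ [_∨_] (cong dual (trWith-agree σ α (λ x o → h x (⇒ˡ o)))) (trWith-agree σ β (λ x o → h x (⇒ʳ o)))
trWith-agree σ (¬ᶠ α) h = cong dual (trWith-agree σ α (λ x o → h x (¬o o)))

size-trWith : ∀ σ → (∀ x → size (σ x) ≡ 1) → ∀ φ → size (trWith σ φ) ≡ fsize φ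
size-trWith σ h ⊤ᶠ = refl
size-trWith σ h ⊥ᶠ = refl
size-trWith σ h (v x) = h x
size-trWith σ h (α ∨ᶠ β) = cong₂ _+_ (size-trWith σ h α) (size-trWith σ h β)
size-trWith σ h (α ∧ᶠ β) = cong₂ _+_ (size-trWith σ h α) (size-trWith σ h β)
size-trWith σ h (α ⇒ β) = cong₂ _+_ (trans (size-dual (trWith σ α)) (size-trWith σ h α)) (size-trWith σ h β)
size-trWith σ h (¬ᶠ α) = trans (size-dual (trWith σ α)) (size-trWith σ h α)

varOcc-dual : ∀ {k} γ → VarOcc k (dual γ) → VarOcc k γ
varOcc-dual (var (p , n)) (here _) = here p
varOcc-dual [ α ∨ β ] (∧ˡ o) = ∨ˡ (varOcc-dual α o)
varOcc-dual [ α ∨ β ] (∧ʳ o) = ∨ʳ (varOcc-dual β o)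
varOcc-dual ⟨ α ∧ β ⟩ (∨ˡ o) = ∧ˡ (varOcc-dual α o)
varOcc-dual ⟨ α ∧ β ⟩ (∨ʳ o) = ∧ʳ (varOcc-dual β o)

varOcc-trWith : ∀ {k} σ φ → VarOcc k (trWith σ φ) → Σ FVar λ x → FOcc x φ × VarOcc k (σ x)
varOcc-trWith σ (v x) o = x , here , o
varOcc-trWith σ (α ∨ᶠ β) (∨ˡ o) with x , p , q ← varOcc-trWith σ α o = x , ∨ˡ p , q
varOcc-trWith σ (α ∨ᶠ β) (∨ʳ o) with x , p , q ← varOcc-trWith σ β o = x , ∨ʳ p , q
varOcc-trWith σ (α ∧ᶠ β) (∧ˡ o) with x , p , q ← varOcc-trWith σ α o = x , ∧ˡ p , q
varOcc-trWith σ (α ∧ᶠ β) (∧ʳ o) with x , p , q ← varOcc-trWith σ β o = x , ∧ʳ p , q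
varOcc-trWith σ (α ⇒ β) (∨ˡ o) with x , p , q ← varOcc-trWith σ α (varOcc-dual (trWith σ α) o) = x , ⇒ˡ p , q
varOcc-trWith σ (α ⇒ β) (∨ʳ o) with x , p , q ← varOcc-trWith σ β o = x , ⇒ʳ p , q
varOcc-trWith σ (¬ᶠ α) o with x , p , q ← varOcc-trWith σ α (varOcc-dual (trWith σ α) o) = x , ¬o p , q

_≟ⱽ_ : DecidableEquality FVar
fatom m ≟ⱽ fatom n = Dec.map′ (cong fatom) (λ { refl → refl }) (m ≟ n)
fatom m ≟ⱽ fvar n = no λ ()
fvar m ≟ⱽ fatom n = no λ ()
fvar m ≟ⱽ fvar n = Dec.map′ (cong fvar) (λ { refl → refl }) (m ≟ n)

occurs? : ∀ x φ → Dec (FOcc x φ)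
occurs? x ⊤ᶠ = no λ ()
occurs? x ⊥ᶠ = no λ ()
occurs? x (v y) = Dec.map′ (λ { refl → here }) (λ { here → refl }) (x ≟ⱽ y)
occurs? x (α ∨ᶠ β) =
  Dec.map′ [ ∨ˡ , ∨ʳ ]′ (λ { (∨ˡ o) → inj₁ o ; (∨ʳ o) → inj₂ o }) (occurs? x α ⊎-dec occurs? x β)
occurs? x (α ∧ᶠ β) =
  Dec.map′ [ ∧ˡ , ∧ʳ ]′ (λ { (∧ˡ o) → inj₁ o ; (∧ʳ o) → inj₂ o }) (occurs? x α ⊎-dec occurs? x β)
occurs? x (α ⇒ β) =
  Dec.map′ [ ⇒ˡ , ⇒ʳ ]′ (λ { (⇒ˡ o) → inj₁ o ; (⇒ʳ o) → inj₂ o }) (occurs? x α ⊎-dec occurs? x β)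
occurs? x (¬ᶠ α) = Dec.map′ ¬o (λ { (¬o o) → o }) (occurs? x α)

-- Extension variables must become CoS variables,
-- but a Frege atom translates to a CoS atom.  So, for a proof of ω, atoms
-- occurring in ω keep their translation, while every other atom m is sent
-- to the variable N + m, where N exceeds every variable name of the proof.
-- Since no extension variable occurs in ω, the conclusion is unchanged and
-- every extension variable x becomes the variable named `name x`.

module Renaming (N : ℕ) (ω : FFm) where

  renameAtom : ∀ m → Dec (FOcc (fatom m) ω) → Fm
  renameAtom m (yes _) = atom (true , m)
  renameAtom m (no _) = var (true , N + m)

  σ : FVar → Fm
  σ (fvar m) = var (true , m)
  σ (fatom m) = renameAtom m (occurs? (fatom m) ω)

  tr′ : FFm → Fm
  tr′ = trWith σ

  name : FVar → ℕ
  name (fvar m) = m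
  name (fatom m) = N + m

  σ-fresh : ∀ {x} → ¬ FOcc x ω → σ x ≡ var (true , name x)
  σ-fresh {fvar m} _ = refl
  σ-fresh {fatom m} fresh with occurs? (fatom m) ω
  ... | yes o = ⊥-elim (fresh o)
  ... | no _ = refl

  tr′-conclusion : tr′ ω ≡ tr ω
  tr′-conclusion = trWith-agree σ ω agree
    where
    agree : ∀ x → FOcc x ω → σ x ≡ trVar x
    agree (fvar m) _ = refl
    agree (fatom m) o with occurs? (fatom m) ω
    ... | yes _ = refl
    ... | no absent = ⊥-elim (absent o)

  size-tr′ : ∀ φ → size (tr′ φ) ≡ fsize φ
  size-tr′ = size-trWith σ size-σ
    where
    size-σ : ∀ x → size (σ x) ≡ 1
    size-σ (fvar m) = refl
    size-σ (fatom m) with occurs? (fatom m) ω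
    ... | yes _ = refl
    ... | no _ = refl

  varOcc-tr′ : ∀ {k} φ → VarOcc k (tr′ φ) → Σ FVar λ x → FOcc x φ × k ≡ name x
  varOcc-tr′ φ o with x , occ , o′ ← varOcc-trWith σ φ o = x , occ , varOcc-σ x o′
    where
    varOcc-σ : ∀ {k} x → VarOcc k (σ x) → k ≡ name x
    varOcc-σ (fvar m) (here _) = refl
    varOcc-σ (fatom m) o with occurs? (fatom m) ω | o
    ... | no _ | here _ = refl

  Small : FVar → Set
  Small (fvar m) = m < N
  Small (fatom _) = ⊤

  name-injective : ∀ x y → Small x → Small y → name x ≡ name y → x ≡ y
  name-injective (fvar m) (fvar k) _ _ e = cong fvar e
  name-injective (fvar m) (fatom k) m<N _ e = ⊥-elim (<⇒≱ m<N (≤-trans (m≤m+n N k) (≤-reflexive (sym e))))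
  name-injective (fatom m) (fvar k) _ k<N e = ⊥-elim (<⇒≱ k<N (≤-trans (m≤m+n N m) (≤-reflexive e)))
  name-injective (fatom m) (fatom k) _ _ e = cong fatom (+-cancelˡ-≡ N m k e)

  clauses : List Definition → List Fm
  clauses [] = []
  clauses ((A , β) ∷ E) =
    [ var (bar (true , name A)) ∨ tr′ β ] ∷ [ dual (tr′ β) ∨ var (true , name A) ] ∷ clauses E

  extClauses-lookup : ∀ E →
    extClauses {length E} (λ i → (true , name (proj₁ (lookup E i)))) (λ i → tr′ (proj₂ (lookup E i))) ≡ clauses E
  extClauses-lookup [] = refl
  extClauses-lookup (d ∷ E) = cong (λ rest → _ ∷ _ ∷ rest) (extClauses-lookup E)

  sizes-clauses : ∀ E → sizes (clauses E) ≡ sumSizes (map definingLine E)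
  sizes-clauses [] = refl
  sizes-clauses ((A , β) ∷ E) = begin
    (1 + size (tr′ β)) + (size (dual (tr′ β)) + 1 + sizes (clauses E))
      ≡⟨ cong₂ (λ p q → (1 + p) + (q + 1 + sizes (clauses E))) (size-tr′ β) (trans (size-dual (tr′ β)) (size-tr′ β)) ⟩
    (1 + fsize β) + (fsize β + 1 + sizes (clauses E))
      ≡⟨ +-assoc (1 + fsize β) (fsize β + 1) _ ⟨
    (1 + fsize β) + (fsize β + 1) + sizes (clauses E)
      ≡⟨ cong ((1 + fsize β) + (fsize β + 1) +_) (sizes-clauses E) ⟩
    (1 + fsize β) + (fsize β + 1) + sumSizes (map definingLine E) ∎
    where open ≡-Reasoning

  clauses-∈ : ∀ {A β} E → (A , β) ∈ E →
    ([ var (bar (true , name A)) ∨ tr′ β ] ∈ clauses E) × ([ dual (tr′ β) ∨ var (true , name A) ] ∈ clauses E)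
  clauses-∈ (_ ∷ E) (here refl) = here refl , there (here refl)
  clauses-∈ (_ ∷ E) (there p) with p₁ , p₂ ← clauses-∈ E p = there (there p₁) , there (there p₂)

  tr′-definingLine : ∀ {A β} → ¬ FOcc A ω →
    tr′ (v A ⇔ β) ≡ ⟨ [ var (bar (true , name A)) ∨ tr′ β ] ∧ [ dual (tr′ β) ∨ var (true , name A) ] ⟩
  tr′-definingLine {A} {β} fresh = cong (λ z → ⟨ [ dual z ∨ tr′ β ] ∧ [ dual (tr′ β) ∨ z ] ⟩) (σ-fresh fresh)

  module Simulation (E : List Definition) (n : ℕ) (clauses-small : sizes (clauses E) ≤ n) where

    memory : List FFm → List Fm
    memory L = map tr′ L ++ clauses E

    bound : ℕ
    bound = 4 * n + 3 * suc (n + n)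

    memory-size : ∀ L → sumSizes L ≤ n → size (stack (memory L)) ≤ suc (n + n)
    memory-size L small = begin
      size (stack (memory L))                  ≡⟨ size-stack (memory L) ⟩
      suc (sizes (map tr′ L ++ clauses E))     ≡⟨ cong suc (sizes-++ (map tr′ L) (clauses E)) ⟩
      suc (sizes (map tr′ L) + sizes (clauses E))
        ≤⟨ s≤s (+-mono-≤ (≤-trans (≤-reflexive (sizes-map L)) small) clauses-small) ⟩
      suc (n + n) ∎
      where
      open ≤-Reasoning
      sizes-map : ∀ L → sizes (map tr′ L) ≡ sumSizes L
      sizes-map [] = refl
      sizes-map (φ ∷ L) = cong₂ _+_ (size-tr′ φ) (sizes-map L)

    tail-small : ∀ φ L → sumSizes (φ ∷ L) ≤ n → sumSizes L ≤ n
    tail-small φ L = ≤-trans (m≤n+m (sumSizes L) (fsize φ))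

    line-bound : ∀ φ L → sumSizes (φ ∷ L) ≤ n → 4 * size (tr′ φ) + 3 * size (stack (memory L)) ≤ bound
    line-bound φ L small =
      +-mono-≤ (*-monoʳ-≤ 4 (≤-trans (≤-reflexive (size-tr′ φ)) (≤-trans (m≤m+n _ _) small)))
               (*-monoʳ-≤ 3 (memory-size L (tail-small φ L small)))

    in-memory : ∀ {φ} L → φ ∈ L → tr′ φ ∈ memory L
    in-memory L p = ∈-++⁺ˡ (∈-map⁺ tr′ p)

    pushDefinition : ∀ L {A β} → ¬ FOcc A ω → (A , β) ∈ E →
                     Push (memory L) (tr′ (v A ⇔ β)) (3 * size (stack (memory L)))
    pushDefinition L {A} {β} fresh def
      with p₁ , p₂ ← clauses-∈ E def
      with D , steps-D , bounded-D ← copyPair (memory L) (∈-++⁺ʳ (map tr′ L) p₁) (∈-++⁺ʳ (map tr′ L) p₂) =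
      subst (λ γ → Push (memory L) γ (3 * size (stack (memory L))))
            (sym (tr′-definingLine {A} {β} fresh)) (D , ≤-trans steps-D (m≤m+n 6 6) , bounded-D)

    simulate : ∀ {L} (V : ValidRev ω L) → (∀ {d} → d ∈ definitions V → d ∈ E) → sumSizes L ≤ n →
               Σ (FreeDer (stack (clauses E)) (stack (memory L))) λ D → steps D ≤ 12 * length L × Bounded bound D
    simulate [] _ _ = done , z≤n , tt
    simulate (_∷_ {φ} {L} (axiom ax) V) defs small
      with D , steps-D , bounded-D ← simulate V defs (tail-small φ L small) =
      then-push D steps-D bounded-D
        (push-mono (line-bound φ L small)
                   (pushAxiom (memory L) (axiomDerivation σ ax)))
    simulate (_∷_ {ψ} {L} (mp p⇒ pφ) V) defs small
      with D , steps-D , bounded-D ← simulate V defs (tail-small ψ L small) =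
      then-push D steps-D bounded-D
        (push-mono (≤-trans (m≤n+m _ (4 * size (tr′ ψ))) (line-bound ψ L small))
                   (modusPonens (memory L) (in-memory L p⇒) (in-memory L pφ)))
    simulate (_∷_ {φ} {L} (ext A β _ _ fresh) V) defs small
      with D , steps-D , bounded-D ← simulate V (λ d → defs (∈-++⁺ˡ d)) (tail-small φ L small) =
      then-push D steps-D bounded-D
        (push-mono (≤-trans (m≤n+m _ (4 * size (tr′ φ))) (line-bound φ L small))
                   (pushDefinition L {A} {β} fresh (defs (∈-++⁺ʳ (definitions V) (here refl)))))

conj≃stack : ∀ l → conj l ≃ stack l
conj≃stack [] = ≃-refl
conj≃stack (γ ∷ []) = ≃-sym (∧-unit γ)
conj≃stack (γ ∷ δ ∷ l) = ≃-ctx (γ ▸∧ □) (conj≃stack (δ ∷ l))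

size-conj : ∀ l → size (conj l) ≤ size (stack l)
size-conj [] = ≤-refl
size-conj (γ ∷ []) = m≤m+n (size γ) 1
size-conj (γ ∷ δ ∷ l) = +-monoʳ-≤ (size γ) (size-conj (δ ∷ l))

maxVar : FFm → ℕ
maxVar ⊤ᶠ = 0
maxVar ⊥ᶠ = 0
maxVar (v (fatom _)) = 0
maxVar (v (fvar m)) = m
maxVar (α ∨ᶠ β) = maxVar α ⊔ maxVar β
maxVar (α ∧ᶠ β) = maxVar α ⊔ maxVar β
maxVar (α ⇒ β) = maxVar α ⊔ maxVar β
maxVar (¬ᶠ α) = maxVar α

occurs-maxVar : ∀ {m φ} → FOcc (fvar m) φ → m ≤ maxVar φ
occurs-maxVar here = ≤-refl
occurs-maxVar (∨ˡ p) = ≤-trans (occurs-maxVar p) (m≤m⊔n _ _)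
occurs-maxVar (∨ʳ p) = ≤-trans (occurs-maxVar p) (m≤n⊔m _ _)
occurs-maxVar (∧ˡ p) = ≤-trans (occurs-maxVar p) (m≤m⊔n _ _)
occurs-maxVar (∧ʳ p) = ≤-trans (occurs-maxVar p) (m≤n⊔m _ _)
occurs-maxVar (⇒ˡ p) = ≤-trans (occurs-maxVar p) (m≤m⊔n _ _)
occurs-maxVar (⇒ʳ p) = ≤-trans (occurs-maxVar p) (m≤n⊔m _ _)
occurs-maxVar (¬o p) = occurs-maxVar p

maxVars : List FFm → ℕ
maxVars [] = 0
maxVars (φ ∷ l) = maxVar φ ⊔ maxVars l

member-maxVars : ∀ {φ l} → φ ∈ l → maxVar φ ≤ maxVars l
member-maxVars (here refl) = m≤m⊔n _ _
member-maxVars (there p) = ≤-trans (member-maxVars p) (m≤n⊔m _ _)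

-- Every formula has size at least 1, so a proof is no longer than its size.
length≤sumSizes : ∀ l → length l ≤ sumSizes l
length≤sumSizes [] = z≤n
length≤sumSizes (φ ∷ l) = +-mono-≤ (fsize-pos φ) (length≤sumSizes l)
  where
  fsize-pos : ∀ φ → 1 ≤ fsize φ
  fsize-pos ⊤ᶠ = s≤s z≤n
  fsize-pos ⊥ᶠ = s≤s z≤n
  fsize-pos (v x) = s≤s z≤n
  fsize-pos (α ∨ᶠ β) = ≤-trans (fsize-pos α) (m≤m+n _ _)
  fsize-pos (α ∧ᶠ β) = ≤-trans (fsize-pos α) (m≤m+n _ _)
  fsize-pos (α ⇒ β) = ≤-trans (fsize-pos α) (m≤m+n _ _)
  fsize-pos (¬ᶠ α) = fsize-pos α

-- The final arithmetic: a free derivation of k ≤ 12 l + 3 steps with all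
-- formulae of size ≤ 4 n + 3 (2 n + 1), where 1 ≤ l ≤ n, yields length and
-- size bounds with the constant 403.

length-arithmetic : ∀ k l → k ≤ 12 * l + 3 → 1 ≤ l → k + k ≤ 403 * l
length-arithmetic k l k≤ 1≤l = begin
  k + k                         ≤⟨ +-mono-≤ k≤ k≤ ⟩
  (12 * l + 3) + (12 * l + 3)   ≡⟨ twice l ⟩
  24 * l + 6 * 1                ≤⟨ +-monoʳ-≤ (24 * l) (*-monoʳ-≤ 6 1≤l) ⟩
  24 * l + 6 * l                ≡⟨ *-distribʳ-+ l 24 6 ⟨
  30 * l                        ≤⟨ *-monoˡ-≤ l (m≤m+n 30 373) ⟩
  403 * l ∎
  where
  open ≤-Reasoning
  twice : ∀ l → (12 * l + 3) + (12 * l + 3) ≡ 24 * l + 6 * 1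
  twice = solve-∀

size-arithmetic : ∀ k l n → k ≤ 12 * l + 3 → l ≤ n → 1 ≤ n →
                  suc (k + k) * (4 * n + 3 * suc (n + n)) ≤ 403 * (n * n)
size-arithmetic k l n k≤ l≤n 1≤n = begin
  suc (k + k) * (4 * n + 3 * suc (n + n)) ≤⟨ *-mono-≤ length-factor bound-factor ⟩
  (31 * n) * (13 * n)                     ≡⟨ product n ⟩
  403 * (n * n) ∎
  where
  open ≤-Reasoning
  product : ∀ n → (31 * n) * (13 * n) ≡ 403 * (n * n)
  product = solve-∀
  doubled : ∀ l → suc ((12 * l + 3) + (12 * l + 3)) ≡ 7 * 1 + 24 * l
  doubled = solve-∀
  expanded : ∀ n → 4 * n + 3 * suc (n + n) ≡ 3 * 1 + 10 * n
  expanded = solve-∀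
  length-factor : suc (k + k) ≤ 31 * n
  length-factor = begin
    suc (k + k)                       ≤⟨ s≤s (+-mono-≤ k≤ k≤) ⟩
    suc ((12 * l + 3) + (12 * l + 3)) ≡⟨ doubled l ⟩
    7 * 1 + 24 * l                    ≤⟨ +-mono-≤ (*-monoʳ-≤ 7 1≤n) (*-monoʳ-≤ 24 l≤n) ⟩
    7 * n + 24 * n                    ≡⟨ *-distribʳ-+ n 7 24 ⟨
    31 * n ∎
  bound-factor : 4 * n + 3 * suc (n + n) ≤ 13 * n
  bound-factor = begin
    4 * n + 3 * suc (n + n)           ≡⟨ expanded n ⟩
    3 * 1 + 10 * n                    ≤⟨ +-monoˡ-≤ (10 * n) (*-monoʳ-≤ 3 1≤n) ⟩
    3 * n + 10 * n                    ≡⟨ *-distribʳ-+ n 3 10 ⟨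
    13 * n ∎

module Construction (ω : FFm) (R : List FFm) (V : ValidRev ω (ω ∷ R)) where

  n : ℕ
  n = sumSizes (ω ∷ R)

  E : List Definition
  E = definitions V

  open Renaming (suc (maxVars (ω ∷ R))) ω

  clauses-small : sizes (clauses E) ≤ n
  clauses-small = ≤-trans (≤-reflexive (sizes-clauses E)) (definitions-size V)

  open Simulation E n clauses-small

  var-of : Fin (length E) → FVar
  var-of i = proj₁ (lookup E i)

  body-of : Fin (length E) → FFm
  body-of i = proj₂ (lookup E i)

  wellDefined : ∀ i → WellDefined ω (ω ∷ R) (lookup E i)
  wellDefined i = All.lookup (definitions-wellDefined V) (∈-lookup i)

  stratified : Stratified E
  stratified = definitions-stratified V

  small : ∀ {x φ} → FOcc x φ → φ ∈ ω ∷ R → Small x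
  small {fvar m} o p = s≤s (≤-trans (occurs-maxVar o) (member-maxVars p))
  small {fatom m} _ _ = tt

  var-small : ∀ i → Small (var-of i)
  var-small i = small (∧ˡ (⇒ˡ here)) (proj₁ (wellDefined i))

  -- The side conditions of xSKSg.  A coincidence of names is a coincidence
  -- of Frege variables, which stratification and well-definedness exclude.

  distinct : ∀ {i j} → name (var-of i) ≡ name (var-of j) → i ≡ j
  distinct {i} {j} e with name-injective _ _ (var-small i) (var-small j) e | <-cmp (toℕ i) (toℕ j)
  ... | _    | tri≈ _ i≡j _ = toℕ-injective i≡j
  ... | xᵢ≡xⱼ | tri< i<j _ _ =
    ⊥-elim (stratified-lookup E stratified i j i<j (subst (λ x → FOcc x _) xᵢ≡xⱼ (∧ˡ (⇒ˡ here))))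
  ... | xᵢ≡xⱼ | tri> _ _ j<i =
    ⊥-elim (stratified-lookup E stratified j i j<i (subst (λ x → FOcc x _) (sym xᵢ≡xⱼ) (∧ˡ (⇒ˡ here))))

  fresh-in-bodies : ∀ i j → toℕ j ≤ toℕ i → ¬ VarOcc (name (var-of i)) (tr′ (body-of j))
  fresh-in-bodies i j j≤i o
    with x , occ , e ← varOcc-tr′ (body-of j) o
    with refl ← name-injective _ _ (var-small i) (small (∧ˡ (⇒ʳ occ)) (proj₁ (wellDefined j))) e
    with m≤n⇒m<n∨m≡n j≤i
  ... | inj₁ j<i = stratified-lookup E stratified j i j<i (∧ˡ (⇒ʳ occ))
  ... | inj₂ j≡i with refl ← toℕ-injective j≡i = proj₂ (proj₂ (wellDefined i)) occ

  fresh-in-conclusion : ∀ i → ¬ VarOcc (name (var-of i)) (tr ω)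
  fresh-in-conclusion i o
    with x , occ , e ← varOcc-tr′ ω (subst (VarOcc _) (sym tr′-conclusion) o)
    with refl ← name-injective _ _ (var-small i) (small occ (here refl)) e =
    proj₁ (proj₂ (wellDefined i)) occ

  premiss : Fm
  premiss = extPremiss (λ i → (true , name (var-of i))) (λ i → tr′ (body-of i))

  initial-memory-size : size (stack (clauses E)) ≤ suc n
  initial-memory-size = ≤-trans (≤-reflexive (size-stack (clauses E))) (s≤s clauses-small)

  premiss-size : size premiss ≤ suc n
  premiss-size = begin
    size premiss               ≡⟨ cong (size ∘ conj) (extClauses-lookup E) ⟩
    size (conj (clauses E))    ≤⟨ size-conj (clauses E) ⟩
    size (stack (clauses E))   ≤⟨ initial-memory-size ⟩
    suc n ∎
    where open ≤-Reasoning

  premiss≃memory : premiss ≃ stack (clauses E)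
  premiss≃memory = subst (_≃ stack (clauses E)) (cong conj (sym (extClauses-lookup E))) (conj≃stack (clauses E))

  suc-n≤bound : suc n ≤ bound
  suc-n≤bound = ≤-trans (s≤s (m≤m+n n n)) (≤-trans (m≤m+n (suc (n + n)) _) (m≤n+m _ (4 * n)))

  forget : FreeDer ⟨ tr′ ω ∧ stack (memory R) ⟩ (tr ω)
  forget = byRule (step (tr′ ω ▸∧ □) (aw↑ _))
             (byEq (subst (⟨ tr′ ω ∧ 𝕥 ⟩ ≃_) tr′-conclusion (∧-unit _)) done)

  forget-bounded : Bounded bound forget
  forget-bounded =
    ≤-trans (≤-reflexive (trans (cong (_+ 1) (size-tr′ ω)) (+-comm (fsize ω) 1)))
            (≤-trans (s≤s (m≤m+n _ _)) suc-n≤bound) ,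
    ≤-trans (≤-reflexive (trans (cong size (sym tr′-conclusion)) (size-tr′ ω)))
            (≤-trans (m≤m+n _ _) (≤-trans (n≤1+n n) suc-n≤bound)) ,
    tt

  whole : Σ (FreeDer premiss (tr ω)) λ D → steps D ≤ 12 * length (ω ∷ R) + 3 × Bounded bound D
  whole with D , steps-D , bounded-D ← simulate V (λ d → d) ≤-refl =
    byEq premiss≃memory (D ++ᶠ forget) ,
    ≤-trans (s≤s (≤-trans (≤-reflexive (steps-++ D forget)) (+-monoˡ-≤ 2 steps-D)))
            (≤-reflexive (sym (+-suc (12 * length (ω ∷ R)) 2))) ,
    ≤-trans initial-memory-size suc-n≤bound ,
    bounded-++ D forget bounded-D forget-bounded

  xProof : XSKSgProof (tr ω)
  xProof = record
    { h = length E
    ; A = λ i → (true , name (var-of i))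
    ; β = λ i → tr′ (body-of i)
    ; distinct = distinct
    ; freshβ = fresh-in-bodies
    ; freshα = fresh-in-conclusion
    ; deriv = alternate (proj₁ whole)
    }

  length-bound : xLength xProof ≤ 403 * length (ω ∷ R)
  length-bound = ≤-trans (alternate-length (proj₁ whole)) (length-arithmetic _ _ (proj₁ (proj₂ whole)) (s≤s z≤n))

  size-bound : xSize xProof ≤ 403 * (n * n)
  size-bound =
    ≤-trans (alternate-size (proj₁ whole) (≤-trans premiss-size suc-n≤bound) (proj₂ (proj₂ whole)))
            (size-arithmetic _ (length (ω ∷ R)) n (proj₁ (proj₂ whole)) (length≤sumSizes (ω ∷ R))
                             (≤-trans (s≤s z≤n) (length≤sumSizes (ω ∷ R))))

theorem5p4 : Σ ℕ λ c → ∀ (α : FFm) (π : XFregeProof α) →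
    Σ (XSKSgProof (tr α)) λ ψ →
      (xLength ψ ≤ c * fLength π) × (xSize ψ ≤ c * (fSize π * fSize π))
theorem5p4 = 403 , λ α π →
  let open Construction α (XFregeProof.earlierRev π) (XFregeProof.valid π)
  in xProof , length-bound , size-bound
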